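{- For all integers $d\geq 2$ and $n\ge d$, $G^{\mathrm{in}}_{\max}(C_{2d},d,n)=T(d,n)$.
   Context: $Q_n$ is the $n$-dimensional hypercube graph on binary $n$-tuples (adjacent iff differing in one coordinate). A sub-$d$-cube of $Q_n$ is obtained by fixing $n-d$ coordinates and letting the other $d$ vary, and is identified with $Q_d$. A configuration in $Q_d$ is a subset of $V(Q_d)$; $K$ is an exact copy of $H$ if some automorphism of $Q_d$ maps $H$ onto $K$. A perfect $2d$-cycle $C_{2d}$ in $Q_d$ is the vertex set of a $2d$-cycle in $Q_d$ in which each of the $d$ pairs of opposite vertices of the cycle are at Hamming distance $d$. For $S\subseteq V(Q_n)$ and $v\in S$, let $G^{\mathrm{in}}_v(H,d,n,S)$ be the number of sub-$d$-cubes $R$ of $Q_n$ containing $v$ such that $S\cap R$ is an exact copy of $H$, and $G^{\mathrm{in}}_{\max}(H,d,n)$ the maximum of $G^{\mathrm{in}}_v(H,d,n,S)$ over all $S\subseteq V(Q_n)$ and $v\in S$. Let $X$ be a set of size $n$. Consider a set $A(d,n)$ of sequences of $d$ distinct elements of $X$. For a sequence $w$, an end-segment of $w$ is the set of the first $j$ elements of $w$ or the set of the last $j$ elements of $w$, for some $1\le j<d$. $A(d,n)$ has Property $U$ if: (1) for all $w,x\in A(d,n)$, if $D$ is an end-segment of $w$ and all elements of $D$ occur in $x$, then $D$ is an end-segment of $x$ whose elements appear in $x$ in the same order as in $w$ (e.g. if $w$ begins $abc$ and $a,b,c$ all occur in $x$, then $x$ begins $abc$ or ends $cba$); (2) a sequence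 and its reversal are not both in $A(d,n)$. $T(d,n)$ is the maximum size of a family $A(d,n)$ with Property $U$. -}

module Defs where

open import Data.Bool using (Bool; true; false; _xor_)
open import Data.Nat using (ℕ; zero; suc; _+_; _≤_; _<_)
open import Data.Fin using (Fin; toℕ)
open import Data.Maybe using (Maybe; just; nothing)
open import Data.Vec using (Vec; []; _∷_)
import Data.Vec as V
open import Data.List using (List; []; _∷_; length; take; reverse)
open import Data.List.Membership.Propositional using (_∈_; _∉_)
open import Data.List.Relation.Unary.All using (All)
open import Data.List.Relation.Unary.Unique.Propositional using (Unique)
open import Data.Product using (Σ; ∃; _×_)
open import Data.Sum using (_⊎_)
open import Relation.Binary.PropositionalEquality using (_≡_)

Vertex : ℕ → Set
Vertex n = Vec Bool n

dist : ∀ {n} → Vertex n → Vertex n → ℕ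
dist [] [] = 0
dist (a ∷ x) (b ∷ y) with a xor b
... | true  = suc (dist x y)
... | false = dist x y

Adj : ∀ {n} → Vertex n → Vertex n → Set
Adj x y = dist x y ≡ 1

Config : ℕ → Set
Config d = Vertex d → Bool

IsAut : ∀ {d} → (Vertex d → Vertex d) → Set
IsAut {d} f =
  Σ (Vertex d → Vertex d) λ g →
    (∀ x → g (f x) ≡ x) × (∀ x → f (g x) ≡ x) ×
    (∀ x y → Adj x y → Adj (f x) (f y)) × (∀ x y → Adj (f x) (f y) → Adj x y)

ExactCopy : ∀ {d} → Config d → Config d → Set
ExactCopy {d} H K = Σ (Vertex d → Vertex d) λ f → IsAut f × (∀ u → K (f u) ≡ H u)

PerfectCycle : ∀ d → (Fin (d + d) → Vertex d) → Set
PerfectCycle d c =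
  (∀ i j → c i ≡ c j → i ≡ j) ×
  (∀ i j → (toℕ j ≡ suc (toℕ i) ⊎ (suc (toℕ i) ≡ d + d × toℕ j ≡ 0)) → Adj (c i) (c j)) ×
  (∀ i j → toℕ j ≡ toℕ i + d → dist (c i) (c j) ≡ d)

CycleSet : ∀ {d} → (Fin (d + d) → Vertex d) → Config d → Set
CycleSet {d} c H = ∀ u → (H u ≡ true → ∃ λ i → c i ≡ u) × ((∃ λ i → c i ≡ u) → H u ≡ true)

IsCopyC2d : ∀ d → Config d → Set
IsCopyC2d d K =
  Σ (Config d) λ H → Σ (Fin (d + d) → Vertex d) λ c →
    PerfectCycle d c × CycleSet c H × ExactCopy H K

-- Sub-d-cubes of Q_n: nothing = free coordinate, just b = fixed to b

SubCube : ℕ → Set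
SubCube n = Vec (Maybe Bool) n

freeCount : ∀ {n} → SubCube n → ℕ
freeCount [] = 0
freeCount (nothing ∷ r) = suc (freeCount r)
freeCount (just _ ∷ r) = freeCount r

InCube : ∀ {n} → SubCube n → Vertex n → Set
InCube [] [] = Data.Unit.⊤ where import Data.Unit
InCube (nothing ∷ r) (_ ∷ v) = InCube r v
InCube (just b ∷ r) (a ∷ v) = (a ≡ b) × InCube r v

-- identification of the subcube with Q_d: free coordinates in increasing order
fill : ∀ {n} → SubCube n → List Bool → Vertex n
fill [] bs = []
fill (just b ∷ r) bs = b ∷ fill r bs
fill (nothing ∷ r) [] = false ∷ fill r []
fill (nothing ∷ r) (b ∷ bs) = b ∷ fill r bs

-- S ∩ R viewed as a configuration in Q_d
trace : ∀ {n} d → (Vertex n → Bool) → SubCube n → Config d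
trace d S R u = S (fill R (V.toList u))

Count : {A : Set} → (A → Set) → ℕ → Set
Count {A} P k = Σ (List A) λ L → Unique L × length L ≡ k × (∀ x → (x ∈ L → P x) × (P x → x ∈ L))

GoodCube : ∀ d n → (Vertex n → Bool) → Vertex n → SubCube n → Set
GoodCube d n S v R = freeCount R ≡ d × InCube R v × IsCopyC2d d (trace d S R)

Gin : ∀ d n → (Vertex n → Bool) → Vertex n → ℕ → Set
Gin d n S v k = Count (GoodCube d n S v) k

IsGmax : ℕ → ℕ → ℕ → Set
IsGmax d n m =
  (Σ (Vertex n → Bool) λ S → Σ (Vertex n) λ v → S v ≡ true × Gin d n S v m) ×
  (∀ S v k → S v ≡ true → Gin d n S v k → k ≤ m)

Seq : ℕ → Set
Seq n = List (Fin n)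

IsFamily : ∀ d n → List (Seq n) → Set
IsFamily d n A = Unique A × All (λ w → length w ≡ d × Unique w) A

-- condition (1): D = take j s with s ∈ {w, reverse w} is an end-segment of w
-- (listed from the outer end inwards); if all its elements occur in x, then x
-- begins with D or ends with the reversal of D.
Cond1 : ∀ d n → List (Seq n) → Set
Cond1 d n A = ∀ w x → w ∈ A → x ∈ A → ∀ j → 1 ≤ j → j < d →
  ∀ s → (s ≡ w ⊎ s ≡ reverse w) →
  All (λ a → a ∈ x) (take j s) →
  (take j x ≡ take j s ⊎ take j (reverse x) ≡ take j s)

Cond2 : ∀ {n} → List (Seq n) → Set
Cond2 A = ∀ w → w ∈ A → reverse w ∉ A

PropertyU : ∀ d n → List (Seq n) → Set
PropertyU d n A = IsFamily d n A × Cond1 d n A × Cond2 A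

IsTmax : ℕ → ℕ → ℕ → Set
IsTmax d n m =
  (Σ (List (Seq n)) λ A → PropertyU d n A × length A ≡ m) ×
  (∀ A → PropertyU d n A → length A ≤ m)

module Submission where

-- Fix a vertex v in a sub-d-cube R. A perfect 2d-cycle in R through v flips the d free
-- coordinates one at a time in some order w and then flips them back in the same order, so
-- its vertices are exactly v with an end-segment of w switched. Reading the cycles at v as
-- such sequences (oriented so as to pick one of w and its reversal), Property U says precisely
-- that the vertex sets of different cycles meet consistently; conversely, switching the
-- end-segments of the members of a family with Property U at the origin yields a
-- configuration with one perfect cycle for each member.

open import Data.Bool using (Bool; true; false; _xor_; not)
open import Data.Bool.Properties using (not-involutive; not-¬; xor-comm) renaming (_≟_ to _≟ᴮ_)
open import Data.Empty using (⊥; ⊥-elim)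
open import Data.Fin using (Fin; zero; suc; toℕ; fromℕ<)
open import Data.Fin.Properties using (toℕ-fromℕ<; toℕ-injective; toℕ<n) renaming (_≟_ to _≟ᶠ_)
import Data.Fin.Properties as Fin
open import Data.List using (List; []; _∷_; length; _++_; _∷ʳ_; take; drop; reverse; map; upTo; concatMap; allFin; filter; deduplicate)
open import Data.List.Properties using (take++drop≡id; unfold-reverse; reverse-involutive; reverse-++; length-reverse; length-take; length-drop; length-++; length-map; length-tabulate; ∷-injective; ∷-injectiveˡ; ++-assoc; ++-identityʳ; take-all; drop-all)
import Data.List.Properties as List
open import Data.List.Membership.Propositional using (_∈_; _∉_; find; lose)
open import Data.List.Membership.Propositional.Properties using (∈-++⁺ˡ; ∈-++⁺ʳ; ∈-++⁻; ∈-map⁺; ∈-map⁻; ∈-upTo⁺; ∈-upTo⁻; ∈-concatMap⁺; ∈-allFin; ∈-deduplicate⁺; ∈-filter⁺; ∈-filter⁻)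
import Data.List.Membership.DecPropositional as DecMembership
open import Data.List.Relation.Unary.All using (All; []; _∷_; all?)
import Data.List.Relation.Unary.All as All
open import Data.List.Relation.Unary.All.Properties using (All¬⇒¬Any; ¬Any⇒All¬)
open import Data.List.Relation.Unary.Any using (Any; here; there; any?)
open import Data.List.Relation.Unary.Any.Properties using () renaming (reverse⁺ to ∈-reverse⁺; reverse⁻ to ∈-reverse⁻)
open import Data.List.Relation.Unary.Unique.Propositional using (Unique; []; _∷_)
import Data.List.Relation.Unary.Unique.Propositional.Properties as Unique
open import Data.List.Relation.Unary.Unique.DecPropositional using (unique?)
open import Data.List.Relation.Unary.Unique.DecPropositional.Properties using (deduplicate-!)
open import Data.Maybe using (Maybe; just; nothing)
open import Data.Maybe.Properties using (just-injective)
open import Data.Nat using (ℕ; zero; suc; _+_; _∸_; _≤_; _<_; z≤n; s≤s; NonZero)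
open import Data.Nat.DivMod using (_%_; m%n<n; %-distribˡ-+; m<n⇒m%n≡m; n%n≡0; [m+n]%n≡m%n; m%n%n≡m%n)
open import Data.Nat.Properties using (_≟_; _<?_; _≤?_; 0≢1+n; suc-injective; ≤-refl; ≤-reflexive; ≤-antisym; ≤-trans; ≤-pred; <-irrefl; <-asym; <-≤-trans; <⇒≤; ≮⇒≥; ≰⇒>; ≤∧≢⇒<; n≢0⇒n>0; m≤n⇒m<n∨m≡n; n≤1+n; m≤m+n; m≤n+m; m<m+n; +-comm; +-assoc; +-suc; +-identityʳ; +-monoˡ-<; +-monoʳ-<; +-monoʳ-≤; +-cancelˡ-≤; +-cancelʳ-≤; +-cancelʳ-<; +-∸-assoc; m+n∸m≡n; m+n∸n≡m; m∸n+n≡m; m+[n∸m]≡n; m∸n≤m; m∸[m∸n]≡n; n∸n≡0; m<n⇒0<n∸m; ∸-monoʳ-<; m≤n⇒m⊓n≡m)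
open import Data.Product using (Σ; ∃; _×_; _,_; proj₁; proj₂)
open import Data.Sum using (_⊎_; inj₁; inj₂; [_,_]′)
open import Data.Unit using (tt)
open import Data.Vec using (Vec; []; _∷_; lookup; tabulate)
open import Data.Vec.Properties using (lookup∘tabulate)
import Data.Vec as Vec
import Data.Vec.Properties as Vec
open import Data.Vec.Relation.Binary.Equality.Cast using (cast-is-id)
open import Function using (_∘_; id)
open import Function.Bundles using (_⇔_; mk⇔)
open import Relation.Binary.Definitions using (DecidableEquality)
open import Relation.Binary.PropositionalEquality using (_≡_; _≢_; refl; sym; trans; cong; cong₂; subst; subst₂; module ≡-Reasoning)
open import Relation.Nullary using (¬_; Dec; yes; no; does)
open import Relation.Nullary.Decidable using (dec-true; dec-false; _⊎-dec_; _×-dec_; _→-dec_; ¬?)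
import Relation.Nullary.Decidable as Dec

open import Defs

SameElements : {A : Set} → List A → List A → Set
SameElements xs ys = ∀ x → (x ∈ xs → x ∈ ys) × (x ∈ ys → x ∈ xs)

module _ {A : Set} where

  head∉tail : ∀ {a : A} {xs} → Unique (a ∷ xs) → a ∉ xs
  head∉tail (a∉xs ∷ _) = All¬⇒¬Any a∉xs

  unique-tail : ∀ {a : A} {xs} → Unique (a ∷ xs) → Unique xs
  unique-tail (_ ∷ u) = u

  unique-∷ : ∀ {a : A} {xs} → a ∉ xs → Unique xs → Unique (a ∷ xs)
  unique-∷ a∉xs u = ¬Any⇒All¬ _ a∉xs ∷ u

  unique-++⇒disjoint : ∀ (xs : List A) {ys x} → Unique (xs ++ ys) → x ∈ xs → x ∉ ys
  unique-++⇒disjoint (a ∷ xs) u (here refl) q = head∉tail u (∈-++⁺ʳ xs q)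
  unique-++⇒disjoint (a ∷ xs) u (there p) q = unique-++⇒disjoint xs (unique-tail u) p q

  unique-∷ʳ : ∀ (xs : List A) {a} → Unique xs → a ∉ xs → Unique (xs ∷ʳ a)
  unique-∷ʳ [] u a∉ = [] ∷ []
  unique-∷ʳ (b ∷ xs) u a∉ = unique-∷ b∉ (unique-∷ʳ xs (unique-tail u) (λ p → a∉ (there p)))
    where
    b∉ : b ∉ xs ∷ʳ _
    b∉ p with ∈-++⁻ xs p
    ... | inj₁ q = head∉tail u q
    ... | inj₂ (here refl) = a∉ (here refl)

  unique-reverse : ∀ {xs : List A} → Unique xs → Unique (reverse xs)
  unique-reverse {[]} u = []
  unique-reverse {a ∷ xs} u = subst Unique (sym (unfold-reverse a xs))
    (unique-∷ʳ (reverse xs) (unique-reverse (unique-tail u)) (λ p → head∉tail u (∈-reverse⁻ p)))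

  ∈-∷⁻ : ∀ {a x : A} {xs} → x ∈ a ∷ xs → x ≢ a → x ∈ xs
  ∈-∷⁻ (here e) ne = ⊥-elim (ne e)
  ∈-∷⁻ (there p) ne = p

  unique-of-≡-or-reverse : ∀ {s xs : List A} → s ≡ xs ⊎ s ≡ reverse xs → Unique xs → Unique s
  unique-of-≡-or-reverse (inj₁ refl) u = u
  unique-of-≡-or-reverse (inj₂ refl) u = unique-reverse u

  length-of-≡-or-reverse : ∀ {s xs : List A} → s ≡ xs ⊎ s ≡ reverse xs → length s ≡ length xs
  length-of-≡-or-reverse (inj₁ refl) = refl
  length-of-≡-or-reverse {xs = xs} (inj₂ refl) = length-reverse xs

  ∈-take⁻ : ∀ m (xs : List A) {x} → x ∈ take m xs → x ∈ xs
  ∈-take⁻ m xs p = subst (_ ∈_) (take++drop≡id m xs) (∈-++⁺ˡ p)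

  ∈-drop⁻ : ∀ m (xs : List A) {x} → x ∈ drop m xs → x ∈ xs
  ∈-drop⁻ m xs p = subst (_ ∈_) (take++drop≡id m xs) (∈-++⁺ʳ (take m xs) p)

  ∈-take-mono : ∀ {i j} (xs : List A) {x} → i ≤ j → x ∈ take i xs → x ∈ take j xs
  ∈-take-mono {suc i} {suc j} (a ∷ xs) _ (here e) = here e
  ∈-take-mono {suc i} {suc j} (a ∷ xs) (s≤s le) (there p) = there (∈-take-mono xs le p)

  take-length-++ : ∀ (xs ys : List A) → take (length xs) (xs ++ ys) ≡ xs
  take-length-++ [] ys = refl
  take-length-++ (a ∷ xs) ys = cong (a ∷_) (take-length-++ xs ys)

  take-++ˡ : ∀ j (xs ys : List A) → j ≤ length xs → take j (xs ++ ys) ≡ take j xs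
  take-++ˡ zero xs ys le = refl
  take-++ˡ (suc j) (a ∷ xs) ys (s≤s le) = cong (a ∷_) (take-++ˡ j xs ys le)

  length-take-≤ : ∀ t (xs : List A) → t ≤ length xs → length (take t xs) ≡ t
  length-take-≤ t xs le = trans (length-take t xs) (m≤n⇒m⊓n≡m le)

  take-suc-∷ʳ : ∀ t (xs : List A) → t < length xs → ∃ λ a → take (suc t) xs ≡ take t xs ∷ʳ a
  take-suc-∷ʳ zero (a ∷ xs) _ = a , refl
  take-suc-∷ʳ (suc t) (b ∷ xs) (s≤s lt) = let (a , p) = take-suc-∷ʳ t xs lt in a , cong (b ∷_) p

  drop-∷ : ∀ m (xs : List A) → m < length xs → ∃ λ a → drop m xs ≡ a ∷ drop (suc m) xs
  drop-∷ zero (a ∷ xs) _ = a , refl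
  drop-∷ (suc m) (b ∷ xs) (s≤s lt) = drop-∷ m xs lt

  SameElements-sym : {xs ys : List A} → SameElements xs ys → SameElements ys xs
  SameElements-sym s x = proj₂ (s x) , proj₁ (s x)

  ∷ʳ-SameElements-∷ : ∀ (xs : List A) a → SameElements (xs ∷ʳ a) (a ∷ xs)
  ∷ʳ-SameElements-∷ xs a x = to , from
    where
    to : x ∈ xs ∷ʳ a → x ∈ a ∷ xs
    to p with ∈-++⁻ xs p
    ... | inj₁ q = there q
    ... | inj₂ (here q) = here q
    from : x ∈ a ∷ xs → x ∈ xs ∷ʳ a
    from (here refl) = ∈-++⁺ʳ xs (here refl)
    from (there q) = ∈-++⁺ˡ q

  SameElements-reverse : ∀ (xs : List A) → SameElements xs (reverse xs)
  SameElements-reverse xs x = ∈-reverse⁺ , ∈-reverse⁻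

  take-∸-reverse : ∀ (xs : List A) s → take (length xs ∸ s) (reverse xs) ≡ reverse (drop s xs)
  take-∸-reverse xs s = begin
    take (length xs ∸ s) (reverse xs)                                  ≡⟨ cong (λ z → take (length xs ∸ s) (reverse z)) (sym (take++drop≡id s xs)) ⟩
    take (length xs ∸ s) (reverse (take s xs ++ drop s xs))            ≡⟨ cong (take (length xs ∸ s)) (reverse-++ (take s xs) (drop s xs)) ⟩
    take (length xs ∸ s) (reverse (drop s xs) ++ reverse (take s xs))  ≡⟨ cong (λ z → take z (reverse (drop s xs) ++ reverse (take s xs))) len ⟩
    take (length (reverse (drop s xs))) (reverse (drop s xs) ++ _)     ≡⟨ take-length-++ (reverse (drop s xs)) _ ⟩
    reverse (drop s xs)                                                ∎
    where
    open ≡-Reasoning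
    len : length xs ∸ s ≡ length (reverse (drop s xs))
    len = sym (trans (length-reverse (drop s xs)) (length-drop s xs))

  last∉proper-prefix : ∀ (xs : List A) d → Unique xs → length xs ≡ suc d →
    ∃ λ l → ∃ λ r → reverse xs ≡ l ∷ r × (∀ j → j ≤ d → l ∉ take j xs)
  last∉proper-prefix xs d u len with reverse xs in eq
  ... | [] = ⊥-elim (0≢len (trans (cong length (sym eq)) (length-reverse xs)))
    where
    0≢len : 0 ≢ length xs
    0≢len e = 0≢1+n (trans e len)
  ... | l ∷ r = l , r , refl , λ j le p → unique-++⇒disjoint (reverse r) u′ (prefix j le p) (here refl)
    where
    xs≡ : xs ≡ reverse r ∷ʳ l
    xs≡ = trans (sym (reverse-involutive xs)) (trans (cong reverse eq) (unfold-reverse l r))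
    u′ : Unique (reverse r ∷ʳ l)
    u′ = subst Unique xs≡ u
    len-r : length (reverse r) ≡ d
    len-r = suc-injective (trans (trans (+-comm 1 _) (sym (length-++ (reverse r)))) (trans (cong length (sym xs≡)) len))
    prefix : ∀ j → j ≤ d → l ∈ take j xs → l ∈ reverse r
    prefix j le p = ∈-take⁻ j (reverse r)
      (subst (l ∈_) (trans (cong (take j) xs≡) (take-++ˡ j (reverse r) _ (subst (j ≤_) (sym len-r) le))) p)

  head≢last : ∀ (a : A) xs d → Unique (a ∷ xs) → length xs ≡ suc d →
    ∃ λ l → ∃ λ r → reverse (a ∷ xs) ≡ l ∷ r × a ≢ l
  head≢last a xs d u len with last∉proper-prefix (a ∷ xs) (suc d) u (cong suc len)
  ... | l , r , eq , l∉ = l , r , eq , λ a≡l → l∉ 1 (s≤s z≤n) (here (sym a≡l))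

  reverse≢self : ∀ (xs : List A) d → Unique xs → length xs ≡ suc (suc d) → reverse xs ≢ xs
  reverse≢self (a ∷ xs) d u len rev≡ with head≢last a xs d u (suc-injective len)
  ... | l , r , rev-eq , a≢l = a≢l (sym (∷-injectiveˡ (trans (sym rev-eq) rev≡)))

  ≡-from-init-and-elements : ∀ j (xs ys : List A) → take j xs ≡ take j ys →
    length xs ≡ suc j → length ys ≡ suc j → SameElements xs ys → Unique xs → Unique ys → xs ≡ ys
  ≡-from-init-and-elements zero (a ∷ []) (b ∷ []) _ _ _ same _ _ with proj₁ (same a) (here refl)
  ... | here a≡b = cong (_∷ []) a≡b
  ≡-from-init-and-elements (suc j) (a ∷ xs) (b ∷ ys) eq lx ly same ux uy with ∷-injective eq
  ... | refl , eq′ = cong (a ∷_) (≡-from-init-and-elements j xs ys eq′ (suc-injective lx) (suc-injective ly)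
                       same′ (unique-tail ux) (unique-tail uy))
    where
    same′ : SameElements xs ys
    same′ x = (λ p → ∈-∷⁻ (proj₁ (same x) (there p)) (λ e → head∉tail ux (subst (_∈ xs) e p)))
            , (λ p → ∈-∷⁻ (proj₂ (same x) (there p)) (λ e → head∉tail uy (subst (_∈ ys) e p)))

  take-≡-from-prefix-elements : ∀ j (xs ys : List A) → Unique xs → Unique ys →
    (∀ i → i ≤ j → SameElements (take i xs) (take i ys)) → take j xs ≡ take j ys
  take-≡-from-prefix-elements zero xs ys ux uy h = refl
  take-≡-from-prefix-elements (suc j) [] [] ux uy h = refl
  take-≡-from-prefix-elements (suc j) [] (b ∷ ys) ux uy h with proj₂ (h 1 (s≤s z≤n) b) (here refl)
  ... | ()
  take-≡-from-prefix-elements (suc j) (a ∷ xs) [] ux uy h with proj₁ (h 1 (s≤s z≤n) a) (here refl)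
  ... | ()
  take-≡-from-prefix-elements (suc j) (a ∷ xs) (b ∷ ys) ux uy h with proj₁ (h 1 (s≤s z≤n) a) (here refl)
  ... | here refl = cong (a ∷_) (take-≡-from-prefix-elements j xs ys (unique-tail ux) (unique-tail uy) h′)
    where
    h′ : ∀ i → i ≤ j → SameElements (take i xs) (take i ys)
    h′ i le x = (λ p → ∈-∷⁻ (proj₁ (h (suc i) (s≤s le) x) (there p)) (λ e → head∉tail ux (∈-take⁻ i xs (subst (_∈ take i xs) e p))))
              , (λ p → ∈-∷⁻ (proj₂ (h (suc i) (s≤s le) x) (there p)) (λ e → head∉tail uy (∈-take⁻ i ys (subst (_∈ take i ys) e p))))

  head∈take∧∉drop : ∀ (xs : List A) → Unique xs → 1 ≤ length xs →
    ∃ λ a → (∀ k → 1 ≤ k → a ∈ take k xs) × (∀ m → 1 ≤ m → a ∉ drop m xs)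
  head∈take∧∉drop (a ∷ xs) u _ = a , (λ { (suc k) _ → here refl }) , (λ { (suc m) _ p → head∉tail u (∈-drop⁻ m xs p) })

  -- A prefix of s matching a prefix of reverse y would contain the last element of y,
  -- which lies outside take j y.
  take-≡-of-prefixes-matching-ends : ∀ d j (s y : List A) → Unique s → Unique y → length y ≡ suc d → j ≤ d →
    (∀ i → i ≤ j → SameElements (take i s) (take i y) ⊎ SameElements (take i s) (take i (reverse y))) →
    SameElements (take j s) (take j y) → take j y ≡ take j s
  take-≡-of-prefixes-matching-ends d j s y us uy ly j≤d ends same-j =
    sym (take-≡-from-prefix-elements j s y us uy forward)
    where
    forward : ∀ i → i ≤ j → SameElements (take i s) (take i y)
    forward zero le x = (λ ()) , (λ ())
    forward (suc i) le with ends (suc i) le | last∉proper-prefix y d uy ly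
    ... | inj₁ same | _ = same
    ... | inj₂ same | l , r , rev-y , l∉ = ⊥-elim (l∉ j j≤d (proj₁ (same-j l) (∈-take-mono s le
            (proj₂ (same l) (subst (λ z → l ∈ take (suc i) z) (sym rev-y) (here refl))))))

module _ {A B : Set} where

  unique-map : ∀ (f : A → B) (xs : List A) → Unique xs →
    (∀ {x y} → x ∈ xs → y ∈ xs → f x ≡ f y → x ≡ y) → Unique (map f xs)
  unique-map f [] u inj = []
  unique-map f (a ∷ xs) u inj = unique-∷ fa∉ (unique-map f xs (unique-tail u) (λ p q e → inj (there p) (there q) e))
    where
    fa∉ : f a ∉ map f xs
    fa∉ p with ∈-map⁻ f p
    ... | y , q , e = head∉tail u (subst (_∈ xs) (sym (inj (here refl) (there q) e)) q)

module UniqueCounting {A : Set} (_≟_ : DecidableEquality A) where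

  remove : A → List A → List A
  remove a [] = []
  remove a (b ∷ xs) with a ≟ b
  ... | yes _ = xs
  ... | no _ = b ∷ remove a xs

  length-remove : ∀ {a} xs → a ∈ xs → suc (length (remove a xs)) ≡ length xs
  length-remove {a} (b ∷ xs) p with a ≟ b
  ... | yes _ = refl
  length-remove {a} (b ∷ xs) (here e) | no ne = ⊥-elim (ne e)
  length-remove {a} (b ∷ xs) (there p) | no ne = cong suc (length-remove xs p)

  ∈-remove⁺ : ∀ {a x} xs → x ∈ xs → x ≢ a → x ∈ remove a xs
  ∈-remove⁺ {a} (b ∷ xs) p ne with a ≟ b
  ∈-remove⁺ {a} (b ∷ xs) (here refl) ne | yes refl = ⊥-elim (ne refl)
  ∈-remove⁺ {a} (b ∷ xs) (there p) ne | yes _ = p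
  ∈-remove⁺ {a} (b ∷ xs) (here e) ne | no _ = here e
  ∈-remove⁺ {a} (b ∷ xs) (there p) ne | no _ = there (∈-remove⁺ xs p ne)

  unique⊆⇒length≤ : ∀ {xs ys : List A} → Unique xs → (∀ x → x ∈ xs → x ∈ ys) → length xs ≤ length ys
  unique⊆⇒length≤ {[]} u sub = z≤n
  unique⊆⇒length≤ {b ∷ xs} {ys} u sub =
    subst (suc (length xs) ≤_) (length-remove ys (sub b (here refl)))
      (s≤s (unique⊆⇒length≤ (unique-tail u)
        (λ x p → ∈-remove⁺ ys (sub x (there p)) (λ e → head∉tail u (subst (_∈ xs) e p)))))

  unique⊆∧length≥⇒⊇ : ∀ {xs ys : List A} → Unique xs → (∀ x → x ∈ xs → x ∈ ys) →
    length ys ≤ length xs → ∀ y → y ∈ ys → y ∈ xs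
  unique⊆∧length≥⇒⊇ {xs} {ys} u sub le y p with DecMembership._∈?_ _≟_ y xs
  ... | yes q = q
  ... | no q = ⊥-elim (<-irrefl refl (≤-trans longer le))
    where
    longer : suc (length xs) ≤ length ys
    longer = subst (suc (length xs) ≤_) (length-remove ys p)
      (s≤s (unique⊆⇒length≤ u (λ x r → ∈-remove⁺ ys (sub x r) (λ e → q (subst (_∈ xs) e r)))))

  length-≡-of-SameElements : ∀ {xs ys : List A} → Unique xs → Unique ys → SameElements xs ys → length xs ≡ length ys
  length-≡-of-SameElements ux uy same =
    ≤-antisym (unique⊆⇒length≤ ux (λ x → proj₁ (same x))) (unique⊆⇒length≤ uy (λ x → proj₂ (same x)))

vertex-ext : ∀ {n} {x y : Vertex n} → (∀ i → lookup x i ≡ lookup y i) → x ≡ y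
vertex-ext {x = []} {[]} h = refl
vertex-ext {x = a ∷ x} {b ∷ y} h = cong₂ _∷_ (h zero) (vertex-ext (λ i → h (suc i)))

flipAt : ∀ {n} → Fin n → Vertex n → Vertex n
flipAt zero (a ∷ x) = not a ∷ x
flipAt (suc i) (a ∷ x) = a ∷ flipAt i x

lookup-flipAt-≡ : ∀ {n} (i : Fin n) x → lookup (flipAt i x) i ≡ not (lookup x i)
lookup-flipAt-≡ zero (a ∷ x) = refl
lookup-flipAt-≡ (suc i) (a ∷ x) = lookup-flipAt-≡ i x

lookup-flipAt-≢ : ∀ {n} (i j : Fin n) x → j ≢ i → lookup (flipAt i x) j ≡ lookup x j
lookup-flipAt-≢ zero zero (a ∷ x) ne = ⊥-elim (ne refl)
lookup-flipAt-≢ zero (suc j) (a ∷ x) ne = refl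
lookup-flipAt-≢ (suc i) zero (a ∷ x) ne = refl
lookup-flipAt-≢ (suc i) (suc j) (a ∷ x) ne = lookup-flipAt-≢ i j x (λ e → ne (cong suc e))

dist-refl : ∀ {n} (x : Vertex n) → dist x x ≡ 0
dist-refl [] = refl
dist-refl (true ∷ x) = dist-refl x
dist-refl (false ∷ x) = dist-refl x

dist-sym : ∀ {n} (x y : Vertex n) → dist x y ≡ dist y x
dist-sym [] [] = refl
dist-sym (true ∷ x) (true ∷ y) = dist-sym x y
dist-sym (true ∷ x) (false ∷ y) = cong suc (dist-sym x y)
dist-sym (false ∷ x) (true ∷ y) = cong suc (dist-sym x y)
dist-sym (false ∷ x) (false ∷ y) = dist-sym x y

dist≡0⇒≡ : ∀ {n} (x y : Vertex n) → dist x y ≡ 0 → x ≡ y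
dist≡0⇒≡ [] [] e = refl
dist≡0⇒≡ (true ∷ x) (true ∷ y) e = cong (true ∷_) (dist≡0⇒≡ x y e)
dist≡0⇒≡ (false ∷ x) (false ∷ y) e = cong (false ∷_) (dist≡0⇒≡ x y e)

dist-triangle : ∀ {n} (x y z : Vertex n) → dist x z ≤ dist x y + dist y z
dist-triangle [] [] [] = z≤n
dist-triangle (a ∷ x) (b ∷ y) (c ∷ z) = step a b c
  where
  ih = dist-triangle x y z
  detour : dist x z ≤ suc (dist x y) + suc (dist y z)
  detour = ≤-trans ih (≤-trans (n≤1+n _) (≤-trans (n≤1+n _) (≤-reflexive (cong suc (sym (+-suc (dist x y) (dist y z)))))))
  jump : suc (dist x z) ≤ dist x y + suc (dist y z)
  jump = subst (suc (dist x z) ≤_) (sym (+-suc (dist x y) (dist y z))) (s≤s ih)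
  step : ∀ a b c → dist (a ∷ x) (c ∷ z) ≤ dist (a ∷ x) (b ∷ y) + dist (b ∷ y) (c ∷ z)
  step true true true = ih
  step true true false = jump
  step true false true = detour
  step true false false = s≤s ih
  step false true true = s≤s ih
  step false true false = detour
  step false false true = jump
  step false false false = ih

dist-flipAt-agree : ∀ {n} (a : Fin n) (x y : Vertex n) → lookup x a ≡ lookup y a → dist x (flipAt a y) ≡ suc (dist x y)
dist-flipAt-agree zero (true ∷ x) (true ∷ y) e = refl
dist-flipAt-agree zero (false ∷ x) (false ∷ y) e = refl
dist-flipAt-agree (suc a) (true ∷ x) (true ∷ y) e = dist-flipAt-agree a x y e
dist-flipAt-agree (suc a) (true ∷ x) (false ∷ y) e = cong suc (dist-flipAt-agree a x y e)
dist-flipAt-agree (suc a) (false ∷ x) (true ∷ y) e = cong suc (dist-flipAt-agree a x y e)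
dist-flipAt-agree (suc a) (false ∷ x) (false ∷ y) e = dist-flipAt-agree a x y e

dist-flipAt-disagree : ∀ {n} (a : Fin n) (x y : Vertex n) → lookup x a ≢ lookup y a → suc (dist x (flipAt a y)) ≡ dist x y
dist-flipAt-disagree zero (true ∷ x) (true ∷ y) e = ⊥-elim (e refl)
dist-flipAt-disagree zero (true ∷ x) (false ∷ y) e = refl
dist-flipAt-disagree zero (false ∷ x) (true ∷ y) e = refl
dist-flipAt-disagree zero (false ∷ x) (false ∷ y) e = ⊥-elim (e refl)
dist-flipAt-disagree (suc a) (true ∷ x) (true ∷ y) e = dist-flipAt-disagree a x y e
dist-flipAt-disagree (suc a) (true ∷ x) (false ∷ y) e = cong suc (dist-flipAt-disagree a x y e)
dist-flipAt-disagree (suc a) (false ∷ x) (true ∷ y) e = cong suc (dist-flipAt-disagree a x y e)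
dist-flipAt-disagree (suc a) (false ∷ x) (false ∷ y) e = dist-flipAt-disagree a x y e

dist-flipAt : ∀ {n} (a : Fin n) (x : Vertex n) → dist x (flipAt a x) ≡ 1
dist-flipAt a x = trans (dist-flipAt-agree a x x refl) (cong suc (dist-refl x))

agree-if-flipAt-increases-dist : ∀ {n} (a : Fin n) (x y : Vertex n) →
  dist x (flipAt a y) ≡ suc (dist x y) → lookup x a ≡ lookup y a
agree-if-flipAt-increases-dist a x y e with lookup x a ≟ᴮ lookup y a
... | yes p = p
... | no p = ⊥-elim (contra (dist x (flipAt a y)) (dist x y) e (dist-flipAt-disagree a x y p))
  where
  contra : ∀ m k → m ≡ suc k → suc m ≡ k → ⊥
  contra m k refl ()

Adj⇒flipAt : ∀ {n} (x y : Vertex n) → Adj x y → ∃ λ a → y ≡ flipAt a x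
Adj⇒flipAt [] [] ()
Adj⇒flipAt (true ∷ x) (true ∷ y) e = let (a , p) = Adj⇒flipAt x y e in suc a , cong (true ∷_) p
Adj⇒flipAt (true ∷ x) (false ∷ y) e = zero , cong (false ∷_) (sym (dist≡0⇒≡ x y (suc-injective e)))
Adj⇒flipAt (false ∷ x) (true ∷ y) e = zero , cong (true ∷_) (sym (dist≡0⇒≡ x y (suc-injective e)))
Adj⇒flipAt (false ∷ x) (false ∷ y) e = let (a , p) = Adj⇒flipAt x y e in suc a , cong (false ∷_) p

_∈ᶠ?_ : ∀ {n} (i : Fin n) (E : List (Fin n)) → Dec (i ∈ E)
i ∈ᶠ? E = any? (i ≟ᶠ_) E

opaque
  _∈ᵇ_ : ∀ {n} → Fin n → List (Fin n) → Bool
  i ∈ᵇ E = does (i ∈ᶠ? E)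

  ∈ᵇ-true : ∀ {n} {i : Fin n} {E} → i ∈ E → i ∈ᵇ E ≡ true
  ∈ᵇ-true {i = i} {E} = dec-true (i ∈ᶠ? E)

  ∈ᵇ-false : ∀ {n} {i : Fin n} {E} → i ∉ E → i ∈ᵇ E ≡ false
  ∈ᵇ-false {i = i} {E} = dec-false (i ∈ᶠ? E)

∈ᵇ-true⁻ : ∀ {n} {i : Fin n} {E} → i ∈ᵇ E ≡ true → i ∈ E
∈ᵇ-true⁻ {i = i} {E} e with i ∈ᶠ? E
... | yes p = p
... | no p with trans (sym e) (∈ᵇ-false p)
... | ()

∈ᵇ-cong : ∀ {n} {E F : List (Fin n)} → SameElements E F → ∀ i → i ∈ᵇ E ≡ i ∈ᵇ F
∈ᵇ-cong {E = E} same i with i ∈ᶠ? E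
... | yes p = trans (∈ᵇ-true p) (sym (∈ᵇ-true (proj₁ (same i) p)))
... | no p = trans (∈ᵇ-false p) (sym (∈ᵇ-false (λ q → p (proj₂ (same i) q))))

∈ᵇ-∷-≢ : ∀ {n} {i a : Fin n} {E} → i ≢ a → i ∈ᵇ (a ∷ E) ≡ i ∈ᵇ E
∈ᵇ-∷-≢ {i = i} {a} {E} ne with i ∈ᶠ? E
... | yes p = trans (∈ᵇ-true (there p)) (sym (∈ᵇ-true p))
... | no p = trans (∈ᵇ-false (λ { (here e) → ne e ; (there q) → p q })) (sym (∈ᵇ-false p))

∈ᵇ-++ : ∀ {n} (E F : List (Fin n)) i → Unique (E ++ F) → i ∈ᵇ F ≡ i ∈ᵇ (E ++ F) xor i ∈ᵇ E
∈ᵇ-++ E F i u with i ∈ᶠ? E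
... | yes p = trans (∈ᵇ-false (unique-++⇒disjoint E u p)) (sym (cong₂ _xor_ (∈ᵇ-true (∈-++⁺ˡ p)) (∈ᵇ-true p)))
... | no p with i ∈ᶠ? F
...   | yes q = trans (∈ᵇ-true q) (sym (cong₂ _xor_ (∈ᵇ-true (∈-++⁺ʳ E q)) (∈ᵇ-false p)))
...   | no q = trans (∈ᵇ-false q) (sym (cong₂ _xor_ (∈ᵇ-false ([ p , q ]′ ∘ ∈-++⁻ E)) (∈ᵇ-false p)))

opaque
  toggle : ∀ {n} → List (Fin n) → Vertex n → Vertex n
  toggle E x = tabulate (λ i → lookup x i xor i ∈ᵇ E)

  lookup-toggle : ∀ {n} (E : List (Fin n)) x i → lookup (toggle E x) i ≡ lookup x i xor i ∈ᵇ E
  lookup-toggle E x i = lookup∘tabulate _ i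

xor-false : ∀ a → a xor false ≡ a
xor-false true = refl
xor-false false = refl

xor-true : ∀ a → a xor true ≡ not a
xor-true true = refl
xor-true false = refl

xor-cancelˡ : ∀ a b c → a xor b ≡ a xor c → b ≡ c
xor-cancelˡ true b c e = trans (sym (not-involutive b)) (trans (cong not e) (not-involutive c))
xor-cancelˡ false b c e = e

xor-assoc : ∀ a b c → (a xor b) xor c ≡ a xor (b xor c)
xor-assoc true true c = sym (not-involutive c)
xor-assoc true false c = refl
xor-assoc false b c = refl

toggle-cong : ∀ {n} {E F : List (Fin n)} x → SameElements E F → toggle E x ≡ toggle F x
toggle-cong x same = vertex-ext λ i →
  trans (lookup-toggle _ x i) (trans (cong (lookup x i xor_) (∈ᵇ-cong same i)) (sym (lookup-toggle _ x i)))

toggle-injective : ∀ {n} {E F : List (Fin n)} x → toggle E x ≡ toggle F x → SameElements E F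
toggle-injective {E = E} {F} x e i =
  (λ p → ∈ᵇ-true⁻ (trans (sym (same i)) (∈ᵇ-true p))) , (λ p → ∈ᵇ-true⁻ (trans (same i) (∈ᵇ-true p)))
  where
  same : ∀ i → i ∈ᵇ E ≡ i ∈ᵇ F
  same i = xor-cancelˡ (lookup x i) _ _
    (trans (sym (lookup-toggle E x i)) (trans (cong (λ z → lookup z i) e) (lookup-toggle F x i)))

toggle-[] : ∀ {n} (x : Vertex n) → toggle [] x ≡ x
toggle-[] x = vertex-ext λ i → trans (lookup-toggle [] x i) (trans (cong (lookup x i xor_) (∈ᵇ-false (λ ()))) (xor-false _))

toggle-toggle : ∀ {n} (E F G : List (Fin n)) x → (∀ i → i ∈ᵇ G ≡ i ∈ᵇ F xor i ∈ᵇ E) →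
  toggle E (toggle F x) ≡ toggle G x
toggle-toggle E F G x h = vertex-ext λ i → begin
  lookup (toggle E (toggle F x)) i        ≡⟨ lookup-toggle E _ i ⟩
  lookup (toggle F x) i xor i ∈ᵇ E         ≡⟨ cong (_xor i ∈ᵇ E) (lookup-toggle F x i) ⟩
  (lookup x i xor i ∈ᵇ F) xor i ∈ᵇ E       ≡⟨ xor-assoc (lookup x i) _ _ ⟩
  lookup x i xor (i ∈ᵇ F xor i ∈ᵇ E)       ≡⟨ cong (lookup x i xor_) (sym (h i)) ⟩
  lookup x i xor i ∈ᵇ G                    ≡⟨ sym (lookup-toggle G x i) ⟩
  lookup (toggle G x) i                    ∎
  where open ≡-Reasoning

toggle-take-drop : ∀ {n} (E : List (Fin n)) s x → Unique E → toggle (take s E) (toggle E x) ≡ toggle (drop s E) x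
toggle-take-drop E s x u = toggle-toggle (take s E) E (drop s E) x λ i →
  subst (λ z → i ∈ᵇ drop s E ≡ i ∈ᵇ z xor i ∈ᵇ take s E) (take++drop≡id s E)
    (∈ᵇ-++ (take s E) (drop s E) i (subst Unique (sym (take++drop≡id s E)) u))

toggle-∷ : ∀ {n} (a : Fin n) E x → a ∉ E → toggle (a ∷ E) x ≡ flipAt a (toggle E x)
toggle-∷ a E x a∉ = vertex-ext λ i → trans (lookup-toggle (a ∷ E) x i) (pointwise i (i ≟ᶠ a))
  where
  pointwise : ∀ i → Dec (i ≡ a) → lookup x i xor i ∈ᵇ (a ∷ E) ≡ lookup (flipAt a (toggle E x)) i
  pointwise i (yes refl) = begin
    lookup x i xor i ∈ᵇ (i ∷ E)      ≡⟨ cong (lookup x i xor_) (∈ᵇ-true (here refl)) ⟩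
    lookup x i xor true              ≡⟨ xor-true _ ⟩
    not (lookup x i)                 ≡⟨ cong not (sym (xor-false _)) ⟩
    not (lookup x i xor false)       ≡⟨ cong (λ b → not (lookup x i xor b)) (sym (∈ᵇ-false a∉)) ⟩
    not (lookup x i xor i ∈ᵇ E)      ≡⟨ cong not (sym (lookup-toggle E x i)) ⟩
    not (lookup (toggle E x) i)      ≡⟨ sym (lookup-flipAt-≡ i _) ⟩
    lookup (flipAt i (toggle E x)) i ∎
    where open ≡-Reasoning
  pointwise i (no ne) = trans (cong (lookup x i xor_) (∈ᵇ-∷-≢ {E = E} ne))
    (trans (sym (lookup-toggle E x i)) (sym (lookup-flipAt-≢ a i _ ne)))

toggle-comm : ∀ {n} (E F : List (Fin n)) x → toggle E (toggle F x) ≡ toggle F (toggle E x)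
toggle-comm E F x = vertex-ext λ i → begin
  lookup (toggle E (toggle F x)) i     ≡⟨ lookup-toggle E _ i ⟩
  lookup (toggle F x) i xor i ∈ᵇ E      ≡⟨ cong (_xor i ∈ᵇ E) (lookup-toggle F x i) ⟩
  (lookup x i xor i ∈ᵇ F) xor i ∈ᵇ E    ≡⟨ xor-assoc (lookup x i) _ _ ⟩
  lookup x i xor (i ∈ᵇ F xor i ∈ᵇ E)    ≡⟨ cong (lookup x i xor_) (xor-comm (i ∈ᵇ F) (i ∈ᵇ E)) ⟩
  lookup x i xor (i ∈ᵇ E xor i ∈ᵇ F)    ≡⟨ sym (xor-assoc (lookup x i) _ _) ⟩
  (lookup x i xor i ∈ᵇ E) xor i ∈ᵇ F    ≡⟨ cong (_xor i ∈ᵇ F) (sym (lookup-toggle E x i)) ⟩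
  lookup (toggle E x) i xor i ∈ᵇ F      ≡⟨ sym (lookup-toggle F _ i) ⟩
  lookup (toggle F (toggle E x)) i     ∎
  where open ≡-Reasoning

dist-toggle-∷ : ∀ {n} (a : Fin n) E x → a ∉ E → dist (toggle E x) (toggle (a ∷ E) x) ≡ 1
dist-toggle-∷ a E x a∉ = trans (cong (dist (toggle E x)) (toggle-∷ a E x a∉)) (dist-flipAt a (toggle E x))

dist-toggle : ∀ {n} (E : List (Fin n)) x → Unique E → dist x (toggle E x) ≡ length E
dist-toggle [] x u = trans (cong (dist x) (toggle-[] x)) (dist-refl x)
dist-toggle (a ∷ E) x u = begin
  dist x (toggle (a ∷ E) x)         ≡⟨ cong (dist x) (toggle-∷ a E x (head∉tail u)) ⟩
  dist x (flipAt a (toggle E x))    ≡⟨ dist-flipAt-agree a x (toggle E x) (sym a-untouched) ⟩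
  suc (dist x (toggle E x))         ≡⟨ cong suc (dist-toggle E x (unique-tail u)) ⟩
  suc (length E)                    ∎
  where
  open ≡-Reasoning
  a-untouched : lookup (toggle E x) a ≡ lookup x a
  a-untouched = trans (lookup-toggle E x a) (trans (cong (lookup x a xor_) (∈ᵇ-false (head∉tail u))) (xor-false _))

data Walk {n} : ℕ → Vertex n → Vertex n → Set where
  [] : ∀ {x} → Walk 0 x x
  _∷_ : ∀ {k x y z} → Adj x y → Walk k y z → Walk (suc k) x z

dist≤walk-length : ∀ {n k} {x y : Vertex n} → Walk k x y → dist x y ≤ k
dist≤walk-length {x = x} [] = ≤-reflexive (dist-refl x)
dist≤walk-length {x = x} {z} (_∷_ {k} {y = y} a w) =
  ≤-trans (dist-triangle x y z) (subst (λ t → t + dist y z ≤ suc k) (sym a) (s≤s (dist≤walk-length w)))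

walk-∷ : ∀ {n k} (b : Bool) {x y : Vertex n} → Walk k x y → Walk k (b ∷ x) (b ∷ y)
walk-∷ b [] = []
walk-∷ true (a ∷ w) = a ∷ walk-∷ true w
walk-∷ false (a ∷ w) = a ∷ walk-∷ false w

geodesic : ∀ {n} (x y : Vertex n) → Walk (dist x y) x y
geodesic [] [] = []
geodesic (true ∷ x) (true ∷ y) = walk-∷ true (geodesic x y)
geodesic (true ∷ x) (false ∷ y) = cong suc (dist-refl x) ∷ walk-∷ false (geodesic x y)
geodesic (false ∷ x) (true ∷ y) = cong suc (dist-refl x) ∷ walk-∷ true (geodesic x y)
geodesic (false ∷ x) (false ∷ y) = walk-∷ false (geodesic x y)

map-walk : ∀ {n k} (f : Vertex n → Vertex n) → (∀ x y → Adj x y → Adj (f x) (f y)) →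
  ∀ {x y} → Walk k x y → Walk k (f x) (f y)
map-walk f hom [] = []
map-walk f hom (a ∷ w) = hom _ _ a ∷ map-walk f hom w

-- Both f and its inverse map geodesics to walks of the same length.
IsAut⇒preserves-dist : ∀ {d} (f : Vertex d → Vertex d) → IsAut f → ∀ x y → dist (f x) (f y) ≡ dist x y
IsAut⇒preserves-dist f (g , gf , fg , f-hom , f-refl) x y = ≤-antisym
  (dist≤walk-length (map-walk f f-hom (geodesic x y)))
  (dist≤walk-length (subst₂ (Walk _) (gf x) (gf y) (map-walk g g-hom (geodesic (f x) (f y)))))
  where
  g-hom : ∀ a b → Adj a b → Adj (g a) (g b)
  g-hom a b p = f-refl (g a) (g b) (subst₂ Adj (sym (fg a)) (sym (fg b)) p)

freeCoords : ∀ {n} → SubCube n → List (Fin n)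
freeCoords [] = []
freeCoords (nothing ∷ r) = zero ∷ map suc (freeCoords r)
freeCoords (just _ ∷ r) = map suc (freeCoords r)

length-freeCoords : ∀ {n} (R : SubCube n) → length (freeCoords R) ≡ freeCount R
length-freeCoords [] = refl
length-freeCoords (nothing ∷ r) = cong suc (trans (length-map suc (freeCoords r)) (length-freeCoords r))
length-freeCoords (just _ ∷ r) = trans (length-map suc (freeCoords r)) (length-freeCoords r)

unique-freeCoords : ∀ {n} (R : SubCube n) → Unique (freeCoords R)
unique-freeCoords [] = []
unique-freeCoords (nothing ∷ r) = unique-∷ zero∉ (Unique.map⁺ Fin.suc-injective (unique-freeCoords r))
  where
  zero∉ : ∀ {n} {E : List (Fin n)} → Fin.zero ∉ map Fin.suc E
  zero∉ p with ∈-map⁻ Fin.suc p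
  ... | _ , _ , ()
unique-freeCoords (just _ ∷ r) = Unique.map⁺ Fin.suc-injective (unique-freeCoords r)

Free : ∀ {n} → SubCube n → Fin n → Set
Free R a = lookup R a ≡ nothing

∈-freeCoords⁺ : ∀ {n} (R : SubCube n) a → Free R a → a ∈ freeCoords R
∈-freeCoords⁺ (nothing ∷ r) zero e = here refl
∈-freeCoords⁺ (nothing ∷ r) (suc a) e = there (∈-map⁺ suc (∈-freeCoords⁺ r a e))
∈-freeCoords⁺ (just _ ∷ r) (suc a) e = ∈-map⁺ suc (∈-freeCoords⁺ r a e)

∈-freeCoords⁻ : ∀ {n} (R : SubCube n) a → a ∈ freeCoords R → Free R a
∈-freeCoords⁻ (nothing ∷ r) zero p = refl
∈-freeCoords⁻ (nothing ∷ r) (suc a) (there p) with ∈-map⁻ suc p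
... | y , q , refl = ∈-freeCoords⁻ r y q
∈-freeCoords⁻ (just _ ∷ r) zero p with ∈-map⁻ suc p
... | _ , _ , ()
∈-freeCoords⁻ (just _ ∷ r) (suc a) p with ∈-map⁻ suc p
... | y , q , refl = ∈-freeCoords⁻ r y q

InCube⇒lookup : ∀ {n} (R : SubCube n) x → InCube R x → ∀ a b → lookup R a ≡ just b → lookup x a ≡ b
InCube⇒lookup (nothing ∷ r) (c ∷ x) h (suc a) b e = InCube⇒lookup r x h a b e
InCube⇒lookup (just b′ ∷ r) (c ∷ x) (p , h) zero b e = trans p (just-injective e)
InCube⇒lookup (just b′ ∷ r) (c ∷ x) (p , h) (suc a) b e = InCube⇒lookup r x h a b e

lookup⇒InCube : ∀ {n} (R : SubCube n) x → (∀ a b → lookup R a ≡ just b → lookup x a ≡ b) → InCube R x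
lookup⇒InCube [] [] h = tt
lookup⇒InCube (nothing ∷ r) (c ∷ x) h = lookup⇒InCube r x (λ a b e → h (suc a) b e)
lookup⇒InCube (just b ∷ r) (c ∷ x) h = h zero b refl , lookup⇒InCube r x (λ a b e → h (suc a) b e)

subCube-≡ : ∀ {n} (R R′ : SubCube n) v → InCube R v → InCube R′ v →
  (∀ a → Free R a → Free R′ a) → (∀ a → Free R′ a → Free R a) → R ≡ R′
subCube-≡ [] [] v _ _ _ _ = refl
subCube-≡ (nothing ∷ r) (nothing ∷ r′) (c ∷ v) h h′ f g =
  cong (nothing ∷_) (subCube-≡ r r′ v h h′ (f ∘ suc) (g ∘ suc))
subCube-≡ (nothing ∷ r) (just b ∷ r′) (c ∷ v) h h′ f g with f zero refl
... | ()
subCube-≡ (just b ∷ r) (nothing ∷ r′) (c ∷ v) h h′ f g with g zero refl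
... | ()
subCube-≡ (just b ∷ r) (just b′ ∷ r′) (c ∷ v) (p , h) (p′ , h′) f g =
  cong₂ (λ z w → just z ∷ w) (trans (sym p) p′) (subCube-≡ r r′ v h h′ (f ∘ suc) (g ∘ suc))

InCube-toggle : ∀ {n} (R : SubCube n) v E → InCube R v → (∀ a → a ∈ E → Free R a) → InCube R (toggle E v)
InCube-toggle R v E h free = lookup⇒InCube R _ λ a b e → begin
  lookup (toggle E v) a    ≡⟨ lookup-toggle E v a ⟩
  lookup v a xor a ∈ᵇ E    ≡⟨ cong (lookup v a xor_) (∈ᵇ-false (λ p → nothing≢just (trans (sym (free a p)) e))) ⟩
  lookup v a xor false     ≡⟨ xor-false _ ⟩
  lookup v a               ≡⟨ InCube⇒lookup R v h a b e ⟩
  b                        ∎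
  where
  open ≡-Reasoning
  nothing≢just : ∀ {b : Bool} → nothing ≢ just b
  nothing≢just ()

toggle-InCube⇒Free : ∀ {n} (R : SubCube n) v E → InCube R v → InCube R (toggle E v) → ∀ a → a ∈ E → Free R a
toggle-InCube⇒Free R v E h h′ a p with lookup R a in eq
... | nothing = refl
... | just b = ⊥-elim (not-¬ (InCube⇒lookup R _ h′ a b eq) (begin
  lookup (toggle E v) a    ≡⟨ lookup-toggle E v a ⟩
  lookup v a xor a ∈ᵇ E    ≡⟨ cong (lookup v a xor_) (∈ᵇ-true p) ⟩
  lookup v a xor true      ≡⟨ xor-true _ ⟩
  not (lookup v a)         ≡⟨ cong not (InCube⇒lookup R v h a b eq) ⟩
  not b                    ∎))
  where open ≡-Reasoning

flipAt-InCube⇒Free : ∀ {n} (R : SubCube n) x a → InCube R x → InCube R (flipAt a x) → Free R a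
flipAt-InCube⇒Free R x a h h′ with lookup R a in eq
... | nothing = refl
... | just b = ⊥-elim (not-¬ (InCube⇒lookup R _ h′ a b eq)
  (trans (lookup-flipAt-≡ a x) (cong not (InCube⇒lookup R x h a b eq))))

project : ∀ {n} → SubCube n → Vertex n → List Bool
project [] [] = []
project (nothing ∷ r) (a ∷ x) = a ∷ project r x
project (just _ ∷ r) (a ∷ x) = project r x

length-project : ∀ {n} (R : SubCube n) x → length (project R x) ≡ freeCount R
length-project [] [] = refl
length-project (nothing ∷ r) (a ∷ x) = cong suc (length-project r x)
length-project (just _ ∷ r) (a ∷ x) = length-project r x

InCube-fill : ∀ {n} (R : SubCube n) bs → InCube R (fill R bs)
InCube-fill [] bs = tt
InCube-fill (just b ∷ r) bs = refl , InCube-fill r bs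
InCube-fill (nothing ∷ r) [] = InCube-fill r []
InCube-fill (nothing ∷ r) (a ∷ bs) = InCube-fill r bs

fill-project : ∀ {n} (R : SubCube n) x → InCube R x → fill R (project R x) ≡ x
fill-project [] [] h = refl
fill-project (nothing ∷ r) (a ∷ x) h = cong (a ∷_) (fill-project r x h)
fill-project (just b ∷ r) (a ∷ x) (refl , h) = cong (a ∷_) (fill-project r x h)

project-fill : ∀ {n} (R : SubCube n) bs → length bs ≡ freeCount R → project R (fill R bs) ≡ bs
project-fill [] [] e = refl
project-fill (just b ∷ r) bs e = project-fill r bs e
project-fill (nothing ∷ r) (a ∷ bs) e = cong (a ∷_) (project-fill r bs (suc-injective e))

dist-fill : ∀ {n d} (R : SubCube n) → freeCount R ≡ d → (a b : Vertex d) →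
  dist (fill R (Vec.toList a)) (fill R (Vec.toList b)) ≡ dist a b
dist-fill [] refl [] [] = refl
dist-fill (just true ∷ r) fc a b = dist-fill r fc a b
dist-fill (just false ∷ r) fc a b = dist-fill r fc a b
dist-fill (nothing ∷ r) refl (true ∷ a) (true ∷ b) = dist-fill r refl a b
dist-fill (nothing ∷ r) refl (true ∷ a) (false ∷ b) = cong suc (dist-fill r refl a b)
dist-fill (nothing ∷ r) refl (false ∷ a) (true ∷ b) = cong suc (dist-fill r refl a b)
dist-fill (nothing ∷ r) refl (false ∷ a) (false ∷ b) = dist-fill r refl a b

vectorOf : ∀ {d} (bs : List Bool) → length bs ≡ d → Vertex d
vectorOf bs refl = Vec.fromList bs

toList-vectorOf : ∀ {d} (bs : List Bool) (e : length bs ≡ d) → Vec.toList (vectorOf bs e) ≡ bs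
toList-vectorOf bs refl = Vec.toList∘fromList bs

toList-injective : ∀ {d} (u u′ : Vertex d) → Vec.toList u ≡ Vec.toList u′ → u ≡ u′
toList-injective u u′ e = trans (sym (cast-is-id refl u)) (Vec.toList-injective refl u u′ e)

module AntipodalWalk {n e : ℕ} (R : SubCube n) (fc : freeCount R ≡ suc e)
  (H : ℕ → Vertex n) (H-in : ∀ t → InCube R (H t))
  (H-adj : ∀ t → Adj (H t) (H (suc t)))
  (H-antipodal : ∀ t → dist (H t) (H (t + suc e)) ≡ suc e) where

  open UniqueCounting (_≟ᶠ_ {n})

  private
    d : ℕ
    d = suc e

  step : ℕ → Fin n
  step t = proj₁ (Adj⇒flipAt (H t) (H (suc t)) (H-adj t))

  H-suc : ∀ t → H (suc t) ≡ flipAt (step t) (H t)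
  H-suc t = proj₂ (Adj⇒flipAt (H t) (H (suc t)) (H-adj t))

  step-free : ∀ t → Free R (step t)
  step-free t = flipAt-InCube⇒Free R (H t) (step t) (H-in t) (subst (InCube R) (H-suc t) (H-in (suc t)))

  steps : ℕ → ℕ → List (Fin n)
  steps t zero = []
  steps t (suc m) = steps t m ∷ʳ step (t + m)

  length-steps : ∀ t m → length (steps t m) ≡ m
  length-steps t zero = refl
  length-steps t (suc m) = trans (length-++ (steps t m)) (trans (cong (_+ 1) (length-steps t m)) (+-comm m 1))

  steps-free : ∀ t m a → a ∈ steps t m → Free R a
  steps-free t (suc m) a p with ∈-++⁻ (steps t m) p
  ... | inj₁ q = steps-free t m a q
  ... | inj₂ (here refl) = step-free (t + m)

  steps-∷ : ∀ t m → steps t (suc m) ≡ step t ∷ steps (suc t) m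
  steps-∷ t zero = cong (λ z → step z ∷ []) (+-identityʳ t)
  steps-∷ t (suc m) = trans (cong (_∷ʳ step (t + suc m)) (steps-∷ t m))
    (cong (λ z → step t ∷ (steps (suc t) m ∷ʳ step z)) (+-suc t m))

  steps-+ : ∀ t m k → steps t (m + k) ≡ steps t m ++ steps (t + m) k
  steps-+ t m zero = trans (cong (steps t) (+-identityʳ m)) (sym (++-identityʳ (steps t m)))
  steps-+ t m (suc k) = trans (cong (steps t) (+-suc m k))
    (trans (cong (_∷ʳ step (t + (m + k))) (steps-+ t m k))
     (trans (++-assoc (steps t m) (steps (t + m) k) _)
       (cong (λ z → steps t m ++ (steps (t + m) k ∷ʳ step z)) (sym (+-assoc t m k)))))

  dist≤steps : ∀ t m → dist (H t) (H (t + m)) ≤ m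
  dist≤steps t zero = subst (λ z → dist (H t) (H z) ≤ 0) (sym (+-identityʳ t)) (≤-reflexive (dist-refl (H t)))
  dist≤steps t (suc m) = subst (λ z → dist (H t) (H z) ≤ suc m) (sym (+-suc t m))
    (≤-trans (dist-triangle (H t) (H (t + m)) (H (suc (t + m))))
      (subst (λ z → dist (H t) (H (t + m)) + z ≤ suc m) (sym (H-adj (t + m)))
        (subst (_≤ suc m) (+-comm 1 _) (s≤s (dist≤steps t m)))))

  -- Any shortcut before step d would make the antipodal vertex closer than d.
  dist-≡-steps : ∀ t m → m ≤ d → dist (H t) (H (t + m)) ≡ m
  dist-≡-steps t m m≤d = ≤-antisym (dist≤steps t m) (+-cancelʳ-≤ (d ∸ m) m X d≤X+rest)
    where
    X = dist (H t) (H (t + m))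
    rest-≤ : dist (H (t + m)) (H (t + d)) ≤ d ∸ m
    rest-≤ = subst (λ z → dist (H (t + m)) (H z) ≤ d ∸ m)
      (trans (+-assoc t m (d ∸ m)) (cong (t +_) (m+[n∸m]≡n m≤d))) (dist≤steps (t + m) (d ∸ m))
    d≤X+rest : m + (d ∸ m) ≤ X + (d ∸ m)
    d≤X+rest = subst (_≤ X + (d ∸ m)) (trans (H-antipodal t) (sym (m+[n∸m]≡n m≤d)))
      (≤-trans (dist-triangle (H t) (H (t + m)) (H (t + d))) (+-monoʳ-≤ X rest-≤))

  -- Within d steps the walk is geodesic, so it never flips the same coordinate twice.
  window : ∀ t m → m ≤ d → H (t + m) ≡ toggle (steps t m) (H t) × Unique (steps t m)
  window t zero _ = trans (cong H (+-identityʳ t)) (sym (toggle-[] (H t))) , []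
  window t (suc m) sm≤d = H-t+sm , unique-∷ʳ (steps t m) uniq a∉
    where
    ih = window t m (≤-trans (n≤1+n m) sm≤d)
    H-t+m = proj₁ ih
    uniq = proj₂ ih
    a = step (t + m)
    grows : dist (H t) (flipAt a (H (t + m))) ≡ suc (dist (H t) (H (t + m)))
    grows = begin
      dist (H t) (flipAt a (H (t + m)))  ≡⟨ cong (dist (H t)) (sym (H-suc (t + m))) ⟩
      dist (H t) (H (suc (t + m)))       ≡⟨ cong (λ z → dist (H t) (H z)) (sym (+-suc t m)) ⟩
      dist (H t) (H (t + suc m))         ≡⟨ dist-≡-steps t (suc m) sm≤d ⟩
      suc m                              ≡⟨ cong suc (sym (dist-≡-steps t m (≤-trans (n≤1+n m) sm≤d))) ⟩
      suc (dist (H t) (H (t + m)))       ∎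
      where open ≡-Reasoning
    a∉ : a ∉ steps t m
    a∉ p with xor-cancelˡ (lookup (H t) a) false (a ∈ᵇ steps t m)
                (trans (xor-false _) (trans (agree-if-flipAt-increases-dist a (H t) (H (t + m)) grows)
                  (trans (cong (λ z → lookup z a) H-t+m) (lookup-toggle (steps t m) (H t) a))))
    ... | e with trans e (∈ᵇ-true p)
    ... | ()
    H-t+sm : H (t + suc m) ≡ toggle (steps t (suc m)) (H t)
    H-t+sm = begin
      H (t + suc m)                           ≡⟨ cong H (+-suc t m) ⟩
      H (suc (t + m))                         ≡⟨ H-suc (t + m) ⟩
      flipAt a (H (t + m))                    ≡⟨ cong (flipAt a) H-t+m ⟩
      flipAt a (toggle (steps t m) (H t))     ≡⟨ sym (toggle-∷ a (steps t m) (H t) a∉) ⟩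
      toggle (a ∷ steps t m) (H t)            ≡⟨ toggle-cong (H t) (SameElements-sym (∷ʳ-SameElements-∷ (steps t m) a)) ⟩
      toggle (steps t (suc m)) (H t)          ∎
      where open ≡-Reasoning

  -- The d steps starting at t + 1 flip every free coordinate, the step at t among them;
  -- it is not among the first d - 1 of them, so it is the last.
  step-periodic : ∀ t → step (t + d) ≡ step t
  step-periodic t with ∈-++⁻ (steps (suc t) e) step-t∈
    where
    next = window (suc t) d ≤-refl
    step-t∈ : step t ∈ steps (suc t) d
    step-t∈ = unique⊆∧length≥⇒⊇ (proj₂ next) (λ x p → ∈-freeCoords⁺ R x (steps-free (suc t) d x p))
      (≤-reflexive (trans (length-freeCoords R) (trans fc (sym (length-steps (suc t) d)))))
      (step t) (∈-freeCoords⁺ R (step t) (step-free t))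
  ... | inj₁ p = ⊥-elim (head∉tail (subst Unique (steps-∷ t e) (proj₂ (window t d ≤-refl))) p)
  ... | inj₂ (here p) = sym (trans p (cong step (sym (+-suc t e))))

  steps-periodic : ∀ s → steps d s ≡ steps 0 s
  steps-periodic zero = refl
  steps-periodic (suc s) = cong₂ _∷ʳ_ (steps-periodic s) (trans (cong step (+-comm d s)) (step-periodic s))

  order : List (Fin n)
  order = steps 0 d

  unique-order : Unique order
  unique-order = proj₂ (window 0 d ≤-refl)

  length-order : length order ≡ d
  length-order = length-steps 0 d

  order-free : ∀ a → a ∈ order → Free R a
  order-free = steps-free 0 d

  take-order : ∀ m → m ≤ d → take m order ≡ steps 0 m
  take-order m m≤d = begin
    take m (steps 0 d)                         ≡⟨ cong (λ z → take m (steps 0 z)) (sym (m+[n∸m]≡n m≤d)) ⟩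
    take m (steps 0 (m + (d ∸ m)))             ≡⟨ cong (take m) (steps-+ 0 m (d ∸ m)) ⟩
    take m (steps 0 m ++ steps m (d ∸ m))      ≡⟨ cong (λ z → take z (steps 0 m ++ steps m (d ∸ m))) (sym (length-steps 0 m)) ⟩
    take (length (steps 0 m)) (steps 0 m ++ _) ≡⟨ take-length-++ (steps 0 m) _ ⟩
    steps 0 m                                  ∎
    where open ≡-Reasoning

  H-first-half : ∀ m → m ≤ d → H m ≡ toggle (take m order) (H 0)
  H-first-half m m≤d = trans (proj₁ (window 0 m m≤d)) (cong (λ z → toggle z (H 0)) (sym (take-order m m≤d)))

  H-second-half : ∀ s → s ≤ d → H (d + s) ≡ toggle (take (d ∸ s) (reverse order)) (H 0)
  H-second-half s s≤d = begin
    H (d + s)                                              ≡⟨ proj₁ (window d s s≤d) ⟩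
    toggle (steps d s) (H d)                               ≡⟨ cong₂ toggle (trans (steps-periodic s) (sym (take-order s s≤d))) (H-first-half d ≤-refl) ⟩
    toggle (take s order) (toggle (take d order) (H 0))    ≡⟨ cong (λ z → toggle (take s order) (toggle z (H 0))) (take-all d order (≤-reflexive length-order)) ⟩
    toggle (take s order) (toggle order (H 0))             ≡⟨ toggle-take-drop order s (H 0) unique-order ⟩
    toggle (drop s order) (H 0)                            ≡⟨ toggle-cong (H 0) (SameElements-reverse (drop s order)) ⟩
    toggle (reverse (drop s order)) (H 0)                  ≡⟨ cong (λ z → toggle z (H 0)) (sym (take-∸-reverse order s)) ⟩
    toggle (take (length order ∸ s) (reverse order)) (H 0) ≡⟨ cong (λ z → toggle (take (z ∸ s) (reverse order)) (H 0)) length-order ⟩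
    toggle (take (d ∸ s) (reverse order)) (H 0)            ∎
    where open ≡-Reasoning

suc-% : ∀ k N .{{_ : NonZero N}} → 1 < N →
  (suc k % N ≡ suc (k % N)) ⊎ (suc (k % N) ≡ N × suc k % N ≡ 0)
suc-% k N 1<N with m≤n⇒m<n∨m≡n (m%n<n k N)
... | inj₁ lt = inj₁ (trans suc-k% (m<n⇒m%n≡m lt))
  where
  suc-k% : suc k % N ≡ suc (k % N) % N
  suc-k% = trans (%-distribˡ-+ 1 k N) (cong (λ z → (z + k % N) % N) (m<n⇒m%n≡m 1<N))
... | inj₂ eq = inj₂ (eq , trans (%-distribˡ-+ 1 k N)
  (trans (cong (λ z → (z + k % N) % N) (m<n⇒m%n≡m 1<N)) (trans (cong (_% N) eq) (n%n≡0 N))))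

+half-% : ∀ k e → let d = suc e in
  (k % (d + d) < d × (k + d) % (d + d) ≡ k % (d + d) + d) ⊎ (k % (d + d) ≡ (k + d) % (d + d) + d)
+half-% k e with k % (suc e + suc e) <? suc e
... | yes lt = inj₁ (lt , trans (%-distribˡ-+ k d N)
  (trans (cong (λ z → (k % N + z) % N) (m<n⇒m%n≡m d<N)) (m<n⇒m%n≡m (+-monoˡ-< d lt))))
  where
  d = suc e
  N = d + d
  d<N : d < N
  d<N = m<m+n d (s≤s z≤n)
... | no ge = inj₂ (sym (trans (cong (_+ d) shifted) (m∸n+n≡m (≮⇒≥ ge))))
  where
  d = suc e
  N = d + d
  r = k % N
  d<N : d < N
  d<N = m<m+n d (s≤s z≤n)
  shifted : (k + d) % N ≡ r ∸ d
  shifted = begin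
    (k + d) % N              ≡⟨ %-distribˡ-+ k d N ⟩
    (r + d % N) % N          ≡⟨ cong (λ z → (r + z) % N) (m<n⇒m%n≡m d<N) ⟩
    (r + d) % N              ≡⟨ cong (λ z → (z + d) % N) (sym (m∸n+n≡m (≮⇒≥ ge))) ⟩
    ((r ∸ d) + d + d) % N    ≡⟨ cong (_% N) (+-assoc (r ∸ d) d d) ⟩
    ((r ∸ d) + N) % N        ≡⟨ [m+n]%n≡m%n (r ∸ d) N ⟩
    (r ∸ d) % N              ≡⟨ m<n⇒m%n≡m (≤-trans (s≤s (m∸n≤m r d)) (m%n<n k N)) ⟩
    r ∸ d                    ∎
    where open ≡-Reasoning

Successor : ∀ {N} → Fin N → Fin N → Set
Successor {N} i j = toℕ j ≡ suc (toℕ i) ⊎ (suc (toℕ i) ≡ N × toℕ j ≡ 0)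

record CubeCycle {n} (d : ℕ) (R : SubCube n) : Set where
  field
    vertex : Fin (d + d) → Vertex n
    inCube : ∀ i → InCube R (vertex i)
    adjacent : ∀ i j → Successor i j → Adj (vertex i) (vertex j)
    antipodal : ∀ i j → toℕ j ≡ toℕ i + d → dist (vertex i) (vertex j) ≡ d

-- Read from any of its vertices, a perfect cycle in a d-dimensional subcube first flips the d free
-- coordinates one by one in some order, then flips them back in the same order.
module CubeCycleStructure {n e : ℕ} {R : SubCube n} (fc : freeCount R ≡ suc e)
  (C : CubeCycle (suc e) R) (i₀ : Fin (suc e + suc e)) where

  open CubeCycle C

  private
    d N : ℕ
    d = suc e
    N = d + d

    index : ℕ → Fin N
    index k = fromℕ< (m%n<n k N)

    toℕ-index : ∀ k → toℕ (index k) ≡ k % N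
    toℕ-index k = toℕ-fromℕ< (m%n<n k N)

    index-toℕ : ∀ (i : Fin N) → index (toℕ i) ≡ i
    index-toℕ i = toℕ-injective (trans (toℕ-index (toℕ i)) (m<n⇒m%n≡m (toℕ<n i)))

    walk : ℕ → Vertex n
    walk t = vertex (index (toℕ i₀ + t))

    walk-0 : walk 0 ≡ vertex i₀
    walk-0 = cong vertex (trans (cong index (+-identityʳ (toℕ i₀))) (index-toℕ i₀))

    walk-adj : ∀ t → Adj (walk t) (walk (suc t))
    walk-adj t = subst (λ z → Adj (walk t) (vertex (index z))) (sym (+-suc (toℕ i₀) t)) (adjacent _ _ succ)
      where
      k = toℕ i₀ + t
      succ : Successor (index k) (index (suc k))
      succ with suc-% k N (s≤s (≤-trans (s≤s z≤n) (m≤n+m d e)))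
      ... | inj₁ p = inj₁ (trans (toℕ-index (suc k)) (trans p (cong suc (sym (toℕ-index k)))))
      ... | inj₂ (p , q) = inj₂ (trans (cong suc (toℕ-index k)) p , trans (toℕ-index (suc k)) q)

    walk-antipodal : ∀ t → dist (walk t) (walk (t + d)) ≡ d
    walk-antipodal t = subst (λ z → dist (walk t) (vertex (index z)) ≡ d) (+-assoc (toℕ i₀) t d) opposite
      where
      k = toℕ i₀ + t
      opposite : dist (vertex (index k)) (vertex (index (k + d))) ≡ d
      opposite with +half-% k e
      ... | inj₁ (_ , p) = antipodal _ _ (trans (toℕ-index (k + d)) (trans p (cong (_+ d) (sym (toℕ-index k)))))
      ... | inj₂ p = trans (dist-sym (vertex (index k)) (vertex (index (k + d))))
        (antipodal _ _ (trans (toℕ-index k) (trans p (cong (_+ d) (sym (toℕ-index (k + d)))))))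

    walk-covers : ∀ (i : Fin N) → ∃ λ t → t < N × walk t ≡ vertex i
    walk-covers i = t , m%n<n X N , cong vertex (toℕ-injective (trans (toℕ-index (toℕ i₀ + t)) lands))
      where
      X = toℕ i + (N ∸ toℕ i₀)
      t = X % N
      lands : (toℕ i₀ + X % N) % N ≡ toℕ i
      lands = begin
        (toℕ i₀ + X % N) % N       ≡⟨ %-distribˡ-+ (toℕ i₀) (X % N) N ⟩
        (toℕ i₀ % N + X % N % N) % N ≡⟨ cong (λ z → (toℕ i₀ % N + z) % N) (m%n%n≡m%n X N) ⟩
        (toℕ i₀ % N + X % N) % N   ≡⟨ sym (%-distribˡ-+ (toℕ i₀) X N) ⟩
        (toℕ i₀ + X) % N           ≡⟨ cong (_% N) (+-comm-∸ (toℕ i₀) (toℕ i) (<⇒≤ (toℕ<n i₀))) ⟩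
        (toℕ i + N) % N            ≡⟨ [m+n]%n≡m%n (toℕ i) N ⟩
        toℕ i % N                  ≡⟨ m<n⇒m%n≡m (toℕ<n i) ⟩
        toℕ i                      ∎
        where
        open ≡-Reasoning
        +-comm-∸ : ∀ a b {c} → a ≤ c → a + (b + (c ∸ a)) ≡ b + c
        +-comm-∸ a b {c} a≤c = begin
          a + (b + (c ∸ a))   ≡⟨ sym (+-assoc a b (c ∸ a)) ⟩
          a + b + (c ∸ a)     ≡⟨ cong (_+ (c ∸ a)) (+-comm a b) ⟩
          b + a + (c ∸ a)     ≡⟨ +-assoc b a (c ∸ a) ⟩
          b + (a + (c ∸ a))   ≡⟨ cong (b +_) (m+[n∸m]≡n a≤c) ⟩
          b + c               ∎

  private
    module Unrolled = AntipodalWalk R fc walk (λ t → inCube _) walk-adj walk-antipodal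

  opaque
    order : List (Fin n)
    order = Unrolled.order

    unique-order : Unique order
    unique-order = Unrolled.unique-order

    length-order : length order ≡ d
    length-order = Unrolled.length-order

    order-free : ∀ a → a ∈ order → Free R a
    order-free = Unrolled.order-free

    private
      walk-first-half : ∀ m → m ≤ d → walk m ≡ toggle (take m order) (walk 0)
      walk-first-half = Unrolled.H-first-half

      walk-second-half : ∀ s → s ≤ d → walk (d + s) ≡ toggle (take (d ∸ s) (reverse order)) (walk 0)
      walk-second-half = Unrolled.H-second-half

  order-spans : SameElements order (freeCoords R)
  order-spans a = (λ p → ∈-freeCoords⁺ R a (order-free a p)) ,
    UniqueCounting.unique⊆∧length≥⇒⊇ _≟ᶠ_ unique-order (λ x p → ∈-freeCoords⁺ R x (order-free x p))
      (≤-reflexive (trans (length-freeCoords R) (trans fc (sym length-order)))) a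

  vertex-prefix : ∀ m → m ≤ d → ∃ λ i → vertex i ≡ toggle (take m order) (vertex i₀)
  vertex-prefix m m≤d = index (toℕ i₀ + m) , trans (walk-first-half m m≤d) (cong (toggle (take m order)) walk-0)

  vertex-suffix : ∀ m → m ≤ d → ∃ λ i → vertex i ≡ toggle (take m (reverse order)) (vertex i₀)
  vertex-suffix m m≤d = index (toℕ i₀ + (d + (d ∸ m))) , (begin
    walk (d + (d ∸ m))                                          ≡⟨ walk-second-half (d ∸ m) (m∸n≤m d m) ⟩
    toggle (take (d ∸ (d ∸ m)) (reverse order)) (walk 0)        ≡⟨ cong₂ (λ z y → toggle (take z (reverse order)) y) (m∸[m∸n]≡n m≤d) walk-0 ⟩
    toggle (take m (reverse order)) (vertex i₀)                  ∎)
    where open ≡-Reasoning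

  vertex-end-segment : ∀ i → ∃ λ m → m ≤ d ×
    (vertex i ≡ toggle (take m order) (vertex i₀) ⊎ vertex i ≡ toggle (take m (reverse order)) (vertex i₀))
  vertex-end-segment i with walk-covers i
  ... | t , t<N , walk-t with t ≤? d
  ...   | yes t≤d = t , t≤d , inj₁ (trans (sym walk-t) (trans (walk-first-half t t≤d) (cong (toggle (take t order)) walk-0)))
  ...   | no t≰d = d ∸ s , m∸n≤m d s , inj₂ (trans (sym walk-t) (trans (cong walk (sym t≡))
                     (trans (walk-second-half s s≤d) (cong (toggle (take (d ∸ s) (reverse order))) walk-0))))
    where
    s = t ∸ d
    t≡ : d + s ≡ t
    t≡ = m+[n∸m]≡n (<⇒≤ (≰⇒> t≰d))
    s≤d : s ≤ d
    s≤d = +-cancelˡ-≤ d s d (subst (_≤ d + d) (sym t≡) (<⇒≤ t<N))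

record TraceCycle {n} (d : ℕ) (R : SubCube n) (S : Vertex n → Bool) : Set where
  field
    cycle : CubeCycle d R
  open CubeCycle cycle public
  field
    covers : ∀ x → InCube R x → S x ≡ true → ∃ λ i → vertex i ≡ x
    inS : ∀ i → S (vertex i) ≡ true

identity-IsAut : ∀ {d} → IsAut {d} (λ x → x)
identity-IsAut = (λ x → x) , (λ _ → refl) , (λ _ → refl) , (λ _ _ p → p) , (λ _ _ p → p)

opaque
  IsCopyC2d⇒TraceCycle : ∀ {n} d (R : SubCube n) (S : Vertex n → Bool) → freeCount R ≡ d →
    IsCopyC2d d (trace d S R) → TraceCycle d R S
  IsCopyC2d⇒TraceCycle {n} d R S fc (H , c , (_ , c-adj , c-antipodal) , c-set , (f , f-aut@(g , gf , fg , f-hom , _) , Kf≡H)) =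
    record { cycle = cycle ; covers = covers ; inS = inS }
    where
    vertex : Fin (d + d) → Vertex n
    vertex i = fill R (Vec.toList (f (c i)))
    dist-vertex : ∀ i j → dist (vertex i) (vertex j) ≡ dist (f (c i)) (f (c j))
    dist-vertex i j = dist-fill R fc (f (c i)) (f (c j))
    cycle : CubeCycle d R
    cycle = record
      { vertex = vertex
      ; inCube = λ i → InCube-fill R _
      ; adjacent = λ i j s → trans (dist-vertex i j) (f-hom _ _ (c-adj i j s))
      ; antipodal = λ i j a → trans (dist-vertex i j) (trans (IsAut⇒preserves-dist f f-aut (c i) (c j)) (c-antipodal i j a))
      }
    inS : ∀ i → S (vertex i) ≡ true
    inS i = trans (Kf≡H (c i)) (proj₂ (c-set (c i)) (i , refl))
    covers : ∀ x → InCube R x → S x ≡ true → ∃ λ i → vertex i ≡ x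
    covers x x∈R Sx = i , trans (cong (λ z → fill R (Vec.toList z)) (trans (cong f ci≡gy) (fg y))) fill-y
      where
      length-x : length (project R x) ≡ d
      length-x = trans (length-project R x) fc
      y : Vertex d
      y = vectorOf (project R x) length-x
      fill-y : fill R (Vec.toList y) ≡ x
      fill-y = trans (cong (fill R) (toList-vectorOf (project R x) length-x)) (fill-project R x x∈R)
      H-gy : H (g y) ≡ true
      H-gy = trans (sym (Kf≡H (g y))) (trans (cong (trace d S R) (fg y)) (trans (cong S fill-y) Sx))
      i : Fin (d + d)
      i = proj₁ (proj₁ (c-set (g y)) H-gy)
      ci≡gy : c i ≡ g y
      ci≡gy = proj₂ (proj₁ (c-set (g y)) H-gy)

TraceCycle⇒IsCopyC2d : ∀ {n} d (R : SubCube n) (S : Vertex n → Bool) → freeCount R ≡ d →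
  (T : TraceCycle d R S) → (∀ i j → TraceCycle.vertex T i ≡ TraceCycle.vertex T j → i ≡ j) →
  IsCopyC2d d (trace d S R)
TraceCycle⇒IsCopyC2d d R S fc T vertex-injective =
  trace d S R , c , (c-injective , c-adj , c-antipodal) , c-set , (λ x → x) , identity-IsAut , (λ _ → refl)
  where
  open TraceCycle T
  length-vertex : ∀ i → length (project R (vertex i)) ≡ d
  length-vertex i = trans (length-project R (vertex i)) fc
  c : Fin (d + d) → Vertex d
  c i = vectorOf (project R (vertex i)) (length-vertex i)
  fill-c : ∀ i → fill R (Vec.toList (c i)) ≡ vertex i
  fill-c i = trans (cong (fill R) (toList-vectorOf _ (length-vertex i))) (fill-project R (vertex i) (inCube i))
  dist-c : ∀ i j → dist (c i) (c j) ≡ dist (vertex i) (vertex j)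
  dist-c i j = trans (sym (dist-fill R fc (c i) (c j))) (cong₂ dist (fill-c i) (fill-c j))
  c-injective : ∀ i j → c i ≡ c j → i ≡ j
  c-injective i j e = vertex-injective i j (trans (sym (fill-c i)) (trans (cong (λ z → fill R (Vec.toList z)) e) (fill-c j)))
  c-adj : ∀ i j → Successor i j → Adj (c i) (c j)
  c-adj i j s = trans (dist-c i j) (adjacent i j s)
  c-antipodal : ∀ i j → toℕ j ≡ toℕ i + d → dist (c i) (c j) ≡ d
  c-antipodal i j a = trans (dist-c i j) (antipodal i j a)
  c-set : CycleSet c (trace d S R)
  c-set y = to , from
    where
    to : trace d S R y ≡ true → ∃ λ i → c i ≡ y
    to Sy with covers (fill R (Vec.toList y)) (InCube-fill R _) Sy
    ... | i , vi≡ = i , toList-injective (c i) y (begin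
      Vec.toList (c i)                              ≡⟨ toList-vectorOf _ (length-vertex i) ⟩
      project R (vertex i)                          ≡⟨ cong (project R) vi≡ ⟩
      project R (fill R (Vec.toList y))             ≡⟨ project-fill R _ (trans (Vec.length-toList y) (sym fc)) ⟩
      Vec.toList y                                  ∎)
      where open ≡-Reasoning
    from : (∃ λ i → c i ≡ y) → trace d S R y ≡ true
    from (i , refl) = trans (cong S (fill-c i)) (inS i)

-- The perfect cycle through v that switches on the coordinates of w one by one and then
-- switches them off again in the same order.
module StandardCycle {n e : ℕ} (v : Vertex n) (w : List (Fin n)) (uw : Unique w) (lw : length w ≡ suc e) where

  open UniqueCounting (_≟ᶠ_ {n})

  private
    d : ℕ
    d = suc e

    segment′ : ∀ t → Dec (t ≤ d) → List (Fin n)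
    segment′ t (yes _) = take t w
    segment′ t (no _) = drop (t ∸ d) w

  opaque
    segment : ℕ → List (Fin n)
    segment t = segment′ t (t ≤? d)

    segment-≤ : ∀ t → t ≤ d → segment t ≡ take t w
    segment-≤ t t≤d with t ≤? d
    ... | yes _ = refl
    ... | no t≰d = ⊥-elim (t≰d t≤d)

    segment-> : ∀ t → d < t → segment t ≡ drop (t ∸ d) w
    segment-> t d<t with t ≤? d
    ... | yes t≤d = ⊥-elim (<-irrefl refl (<-≤-trans d<t t≤d))
    ... | no _ = refl

    segment-≥ : ∀ t → d ≤ t → segment t ≡ drop (t ∸ d) w
    segment-≥ t d≤t with t ≤? d
    ... | yes t≤d = trans (cong (λ z → take z w) t≡d) (trans (take-all d w (≤-reflexive lw))
                      (cong (λ z → drop z w) (sym (trans (cong (_∸ d) t≡d) (n∸n≡0 d)))))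
      where
      t≡d : t ≡ d
      t≡d = ≤-antisym t≤d d≤t
    ... | no _ = refl

    segment⊆w : ∀ t a → a ∈ segment t → a ∈ w
    segment⊆w t a p with t ≤? d
    ... | yes _ = ∈-take⁻ t w p
    ... | no _ = ∈-drop⁻ (t ∸ d) w p

    unique-segment : ∀ t → Unique (segment t)
    unique-segment t with t ≤? d
    ... | yes _ = Unique.take⁺ t uw
    ... | no _ = Unique.drop⁺ (t ∸ d) uw

  corner : ℕ → Vertex n
  corner t = toggle (segment t) v

  length-segment-≤ : ∀ t → t ≤ d → length (segment t) ≡ t
  length-segment-≤ t t≤d = trans (cong length (segment-≤ t t≤d)) (length-take-≤ t w (≤-trans t≤d (≤-reflexive (sym lw))))

  length-segment-> : ∀ t → d < t → length (segment t) ≡ d ∸ (t ∸ d)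
  length-segment-> t d<t = trans (cong length (segment-> t d<t)) (trans (length-drop (t ∸ d) w) (cong (_∸ (t ∸ d)) lw))

  -- The first coordinate of w distinguishes nonempty segments of the first half from those of the second.
  first-and-second-half-differ : ∀ t t′ → t′ < d + d → t ≤ d → d < t′ → ¬ SameElements (segment t) (segment t′)
  first-and-second-half-differ t t′ t′<2d t≤d d<t′ same with head∈take∧∉drop w uw (subst (1 ≤_) (sym lw) (s≤s z≤n))
  ... | a , a∈take , a∉drop = a∉drop (t′ ∸ d) (m<n⇒0<n∸m d<t′)
    (subst (a ∈_) (segment-> t′ d<t′) (proj₁ (same a) (subst (a ∈_) (sym (segment-≤ t t≤d)) (a∈take t 1≤t))))
    where
    t≡ : t ≡ d ∸ (t′ ∸ d)
    t≡ = trans (sym (length-segment-≤ t t≤d))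
      (trans (length-≡-of-SameElements (unique-segment t) (unique-segment t′) same) (length-segment-> t′ d<t′))
    1≤t : 1 ≤ t
    1≤t = subst (1 ≤_) (sym t≡) (m<n⇒0<n∸m (+-cancelʳ-< d (t′ ∸ d) d
      (subst (_< d + d) (sym (m∸n+n≡m (<⇒≤ d<t′))) t′<2d)))

  segment-injective : ∀ t t′ → t < d + d → t′ < d + d → SameElements (segment t) (segment t′) → t ≡ t′
  segment-injective t t′ t<2d t′<2d same = by-halves (t ≤? d) (t′ ≤? d)
    where
    same-length = length-≡-of-SameElements (unique-segment t) (unique-segment t′) same
    excess≤d : ∀ k → d ≤ k → k < d + d → k ∸ d ≤ d
    excess≤d k d≤k k<2d = +-cancelʳ-≤ d (k ∸ d) d (≤-trans (≤-reflexive (m∸n+n≡m d≤k)) (<⇒≤ k<2d))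
    by-halves : Dec (t ≤ d) → Dec (t′ ≤ d) → t ≡ t′
    by-halves (yes t≤d) (yes t′≤d) = trans (sym (length-segment-≤ t t≤d)) (trans same-length (length-segment-≤ t′ t′≤d))
    by-halves (yes t≤d) (no t′≰d) = ⊥-elim (first-and-second-half-differ t t′ t′<2d t≤d (≰⇒> t′≰d) same)
    by-halves (no t≰d) (yes t′≤d) = ⊥-elim (first-and-second-half-differ t′ t t<2d t′≤d (≰⇒> t≰d) (SameElements-sym same))
    by-halves (no t≰d) (no t′≰d) = trans (sym (m∸n+n≡m d≤t)) (trans (cong (_+ d) excess) (m∸n+n≡m d≤t′))
      where
      d≤t = <⇒≤ (≰⇒> t≰d)
      d≤t′ = <⇒≤ (≰⇒> t′≰d)
      excess : t ∸ d ≡ t′ ∸ d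
      excess = trans (sym (m∸[m∸n]≡n (excess≤d t d≤t t<2d)))
        (trans (cong (d ∸_) (trans (sym (length-segment-> t (≰⇒> t≰d))) (trans same-length (length-segment-> t′ (≰⇒> t′≰d)))))
          (m∸[m∸n]≡n (excess≤d t′ d≤t′ t′<2d)))

  corner-adjacent-≤ : ∀ t → suc t ≤ d → Adj (corner t) (corner (suc t))
  corner-adjacent-≤ t st≤d with take-suc-∷ʳ t w (subst (t <_) (sym lw) st≤d)
  ... | a , take-st = begin
    dist (corner t) (corner (suc t))                       ≡⟨ cong₂ (λ E F → dist (toggle E v) (toggle F v)) (segment-≤ t (<⇒≤ st≤d)) (segment-≤ (suc t) st≤d) ⟩
    dist (toggle (take t w) v) (toggle (take (suc t) w) v) ≡⟨ cong (λ E → dist (toggle (take t w) v) (toggle E v)) take-st ⟩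
    dist (toggle (take t w) v) (toggle (take t w ∷ʳ a) v)  ≡⟨ cong (dist (toggle (take t w) v)) (toggle-cong v (∷ʳ-SameElements-∷ (take t w) a)) ⟩
    dist (toggle (take t w) v) (toggle (a ∷ take t w) v)   ≡⟨ dist-toggle-∷ a (take t w) v a∉ ⟩
    1                                                      ∎
    where
    open ≡-Reasoning
    a∉ : a ∉ take t w
    a∉ p = unique-++⇒disjoint (take t w) (subst Unique take-st (Unique.take⁺ (suc t) uw)) p (here refl)

  corner-adjacent-> : ∀ t → d < suc t → suc t < d + d → Adj (corner t) (corner (suc t))
  corner-adjacent-> t d<st st<2d with drop-∷ (t ∸ d) w (subst (t ∸ d <_) (sym lw) excess<d)
    where
    excess<d : t ∸ d < d
    excess<d = +-cancelʳ-< d (t ∸ d) d (subst (_< d + d) (sym (m∸n+n≡m (≤-pred d<st))) (≤-trans (n≤1+n _) st<2d))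
  ... | a , drop-t = begin
    dist (corner t) (corner (suc t))                       ≡⟨ cong₂ (λ E F → dist (toggle E v) (toggle F v)) seg-t (segment-> (suc t) d<st) ⟩
    dist (toggle (a ∷ rest) v) (toggle rest v)             ≡⟨ dist-sym (toggle (a ∷ rest) v) (toggle rest v) ⟩
    dist (toggle rest v) (toggle (a ∷ rest) v)             ≡⟨ dist-toggle-∷ a rest v (head∉tail (subst Unique seg-t (unique-segment t))) ⟩
    1                                                      ∎
    where
    open ≡-Reasoning
    rest = drop (suc t ∸ d) w
    seg-t : segment t ≡ a ∷ rest
    seg-t = trans (segment-≥ t (≤-pred d<st)) (trans drop-t (cong (λ z → a ∷ drop z w) (sym (+-∸-assoc 1 (≤-pred d<st)))))

  corner-adjacent : ∀ t → suc t < d + d → Adj (corner t) (corner (suc t))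
  corner-adjacent t st<2d = by-half (suc t ≤? d)
    where
    by-half : Dec (suc t ≤ d) → Adj (corner t) (corner (suc t))
    by-half (yes st≤d) = corner-adjacent-≤ t st≤d
    by-half (no st≰d) = corner-adjacent-> t (≰⇒> st≰d) st<2d

  corner-wraps : ∀ t → suc t ≡ d + d → Adj (corner t) (corner 0)
  corner-wraps t st≡2d with drop-∷ e w (subst (e <_) (sym lw) ≤-refl)
  ... | a , drop-e = begin
    dist (corner t) (corner 0)                  ≡⟨ cong₂ (λ E F → dist (toggle E v) (toggle F v)) seg-t (segment-≤ 0 z≤n) ⟩
    dist (toggle (a ∷ []) v) (toggle [] v)      ≡⟨ dist-sym (toggle (a ∷ []) v) (toggle [] v) ⟩
    dist (toggle [] v) (toggle (a ∷ []) v)      ≡⟨ dist-toggle-∷ a [] v (λ ()) ⟩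
    1                                           ∎
    where
    open ≡-Reasoning
    t≡ : t ≡ e + d
    t≡ = suc-injective st≡2d
    seg-t : segment t ≡ a ∷ []
    seg-t = begin
      segment t              ≡⟨ segment-≥ t (subst (d ≤_) (sym t≡) (m≤n+m d e)) ⟩
      drop (t ∸ d) w         ≡⟨ cong (λ z → drop z w) (trans (cong (_∸ d) t≡) (m+n∸n≡m e d)) ⟩
      drop e w               ≡⟨ drop-e ⟩
      a ∷ drop d w           ≡⟨ cong (a ∷_) (drop-all d w (≤-reflexive lw)) ⟩
      a ∷ []                 ∎

  corner-antipodal : ∀ t → t < d → dist (corner t) (corner (t + d)) ≡ d
  corner-antipodal t t<d = begin
    dist (corner t) (corner (t + d))                          ≡⟨ cong₂ (λ E F → dist (toggle E v) (toggle F v)) (segment-≤ t (<⇒≤ t<d)) seg-t+d ⟩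
    dist (toggle (take t w) v) (toggle (drop t w) v)          ≡⟨ cong (dist (toggle (take t w) v)) (sym (toggle-take-drop w t v uw)) ⟩
    dist (toggle (take t w) v) (toggle (take t w) (toggle w v)) ≡⟨ cong (dist (toggle (take t w) v)) (toggle-comm (take t w) w v) ⟩
    dist (toggle (take t w) v) (toggle w (toggle (take t w) v)) ≡⟨ dist-toggle w (toggle (take t w) v) uw ⟩
    length w                                                  ≡⟨ lw ⟩
    d                                                         ∎
    where
    open ≡-Reasoning
    seg-t+d : segment (t + d) ≡ drop t w
    seg-t+d = trans (segment-≥ (t + d) (m≤n+m d t)) (cong (λ z → drop z w) (m+n∸n≡m t d))

  corner-injective : ∀ (i j : Fin (d + d)) → corner (toℕ i) ≡ corner (toℕ j) → i ≡ j
  corner-injective i j eq = toℕ-injective (segment-injective (toℕ i) (toℕ j) (toℕ<n i) (toℕ<n j) (toggle-injective v eq))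

  cubeCycle : (R : SubCube n) → InCube R v → (∀ a → a ∈ w → Free R a) → CubeCycle d R
  cubeCycle R v∈R w-free = record
    { vertex = λ i → corner (toℕ i)
    ; inCube = λ i → InCube-toggle R v (segment (toℕ i)) v∈R (λ a p → w-free a (segment⊆w (toℕ i) a p))
    ; adjacent = adjacent
    ; antipodal = λ i j eq → subst (λ z → dist (corner (toℕ i)) (corner z) ≡ d) (sym eq)
        (corner-antipodal (toℕ i) (+-cancelʳ-< d (toℕ i) d (subst (_< d + d) eq (toℕ<n j))))
    }
    where
    adjacent : ∀ i j → Successor i j → Adj (corner (toℕ i)) (corner (toℕ j))
    adjacent i j (inj₁ eq) = subst (λ z → Adj (corner (toℕ i)) (corner z)) (sym eq)
      (corner-adjacent (toℕ i) (subst (_< d + d) eq (toℕ<n j)))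
    adjacent i j (inj₂ (eq , j≡0)) = subst (λ z → Adj (corner (toℕ i)) (corner z)) (sym j≡0) (corner-wraps (toℕ i) eq)

  corner-take : ∀ k → k ≤ d → corner k ≡ toggle (take k w) v
  corner-take k k≤d = cong (λ E → toggle E v) (segment-≤ k k≤d)

  drop-SameElements-take-reverse : ∀ s → SameElements (drop s w) (take (d ∸ s) (reverse w))
  drop-SameElements-take-reverse s = subst (λ z → SameElements (drop s w) (take (z ∸ s) (reverse w))) lw
    (subst (SameElements (drop s w)) (sym (take-∸-reverse w s)) (SameElements-reverse (drop s w)))

  corner-take-reverse : ∀ k → k ≤ d → ∃ λ t → t < d + d × corner t ≡ toggle (take k (reverse w)) v
  corner-take-reverse zero _ = 0 , s≤s z≤n , corner-take 0 z≤n
  corner-take-reverse (suc k) k≤d = d + (d ∸ suc k) , +-monoʳ-< d (∸-monoʳ-< (s≤s z≤n) k≤d) , (begin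
    toggle (segment (d + (d ∸ suc k))) v        ≡⟨ cong (λ E → toggle E v) (segment-≥ _ (m≤m+n d (d ∸ suc k))) ⟩
    toggle (drop (d + (d ∸ suc k) ∸ d) w) v     ≡⟨ cong (λ z → toggle (drop z w) v) (m+n∸m≡n d (d ∸ suc k)) ⟩
    toggle (drop (d ∸ suc k) w) v               ≡⟨ toggle-cong v (drop-SameElements-take-reverse (d ∸ suc k)) ⟩
    toggle (take (d ∸ (d ∸ suc k)) (reverse w)) v ≡⟨ cong (λ z → toggle (take z (reverse w)) v) (m∸[m∸n]≡n k≤d) ⟩
    toggle (take (suc k) (reverse w)) v         ∎)
    where open ≡-Reasoning

  corner-end-segment : ∀ t → ∃ λ k → k ≤ d × (corner t ≡ toggle (take k w) v ⊎ corner t ≡ toggle (take k (reverse w)) v)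
  corner-end-segment t = by-half (t ≤? d)
    where
    by-half : Dec (t ≤ d) → ∃ λ k → k ≤ d × (corner t ≡ toggle (take k w) v ⊎ corner t ≡ toggle (take k (reverse w)) v)
    by-half (yes t≤d) = t , t≤d , inj₁ (corner-take t t≤d)
    by-half (no t≰d) = d ∸ (t ∸ d) , m∸n≤m d (t ∸ d) ,
      inj₂ (trans (cong (λ E → toggle E v) (segment-> t (≰⇒> t≰d))) (toggle-cong v (drop-SameElements-take-reverse (t ∸ d))))

fixedUnless : ∀ {P : Set} → Dec P → Bool → Maybe Bool
fixedUnless (yes _) b = nothing
fixedUnless (no _) b = just b

module _ {P : Set} where

  fixedUnless-nothing⁻ : ∀ (p : Dec P) {b} → fixedUnless p b ≡ nothing → P
  fixedUnless-nothing⁻ (yes q) _ = q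

  fixedUnless-nothing⁺ : ∀ (p : Dec P) {b} → P → fixedUnless p b ≡ nothing
  fixedUnless-nothing⁺ (yes _) _ = refl
  fixedUnless-nothing⁺ (no ¬q) q = ⊥-elim (¬q q)

  fixedUnless-just⁻ : ∀ (p : Dec P) {b c} → fixedUnless p b ≡ just c → b ≡ c
  fixedUnless-just⁻ (no _) e = just-injective e

spannedCube : ∀ {n} → Vertex n → List (Fin n) → SubCube n
spannedCube v E = tabulate (λ i → fixedUnless (i ∈ᶠ? E) (lookup v i))

module _ {n} (v : Vertex n) (E : List (Fin n)) where

  lookup-spannedCube : ∀ i → lookup (spannedCube v E) i ≡ fixedUnless (i ∈ᶠ? E) (lookup v i)
  lookup-spannedCube i = lookup∘tabulate _ i

  Free-spannedCube⁻ : ∀ i → Free (spannedCube v E) i → i ∈ E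
  Free-spannedCube⁻ i h = fixedUnless-nothing⁻ (i ∈ᶠ? E) (trans (sym (lookup-spannedCube i)) h)

  Free-spannedCube⁺ : ∀ i → i ∈ E → Free (spannedCube v E) i
  Free-spannedCube⁺ i p = trans (lookup-spannedCube i) (fixedUnless-nothing⁺ (i ∈ᶠ? E) p)

  InCube-spannedCube : InCube (spannedCube v E) v
  InCube-spannedCube = lookup⇒InCube (spannedCube v E) v
    λ a b h → fixedUnless-just⁻ (a ∈ᶠ? E) (trans (sym (lookup-spannedCube a)) h)

  freeCount-spannedCube : Unique E → freeCount (spannedCube v E) ≡ length E
  freeCount-spannedCube u = trans (sym (length-freeCoords (spannedCube v E)))
    (length-≡-of-SameElements (unique-freeCoords (spannedCube v E)) u λ a →
      (λ p → Free-spannedCube⁻ a (∈-freeCoords⁻ (spannedCube v E) a p)) , (λ p → ∈-freeCoords⁺ (spannedCube v E) a (Free-spannedCube⁺ a p)))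
    where open UniqueCounting (_≟ᶠ_ {n})

  ≡-spannedCube : ∀ (R : SubCube n) → InCube R v → SameElements (freeCoords R) E → R ≡ spannedCube v E
  ≡-spannedCube R v∈R same = subCube-≡ R (spannedCube v E) v v∈R InCube-spannedCube
    (λ a h → Free-spannedCube⁺ a (proj₁ (same a) (∈-freeCoords⁺ R a h)))
    (λ a h → ∈-freeCoords⁻ R a (proj₂ (same a) (Free-spannedCube⁻ a h)))

EndSegmentVertex : ∀ {n} → Vertex n → List (Fin n) → ℕ → Vertex n → Set
EndSegmentVertex v w k x = x ≡ toggle (take k w) v ⊎ x ≡ toggle (take k (reverse w)) v

EndSegmentVertex-reverse : ∀ {n} (v : Vertex n) w {k x} → EndSegmentVertex v w k x → EndSegmentVertex v (reverse w) k x
EndSegmentVertex-reverse v w {k} (inj₁ e) = inj₂ (trans e (cong (λ z → toggle (take k z) v) (sym (reverse-involutive w))))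
EndSegmentVertex-reverse v w (inj₂ e) = inj₁ e

-- Each member w of A contributes the perfect cycle of the cube it spans, and Property U
-- makes these the only sub-d-cubes at the origin meeting the configuration in a perfect cycle.
module FamilyConfiguration {n e : ℕ} (A : List (Seq n)) (pu : PropertyU (suc (suc e)) n A) where

  open UniqueCounting (_≟ᶠ_ {n})

  private
    d : ℕ
    d = suc (suc e)

    cond1 = proj₁ (proj₂ pu)
    cond2 = proj₂ (proj₂ pu)

    length-member : ∀ {w} → w ∈ A → length w ≡ d
    length-member p = proj₁ (All.lookup (proj₂ (proj₁ pu)) p)

    unique-member : ∀ {w} → w ∈ A → Unique w
    unique-member p = proj₂ (All.lookup (proj₂ (proj₁ pu)) p)

  origin : Vertex n
  origin = Vec.replicate n false

  InConfiguration : Vertex n → Set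
  InConfiguration x = ∃ λ w → w ∈ A × ∃ λ k → k ≤ d × EndSegmentVertex origin w k x

  private
    inConfiguration? : ∀ x → Dec (Any (λ w → Any (λ k → EndSegmentVertex origin w k x) (upTo (suc d))) A)
    inConfiguration? x = any? (λ w → any? (λ k → (x ≟ⱽ _) ⊎-dec (x ≟ⱽ _)) (upTo (suc d))) A
      where _≟ⱽ_ = Vec.≡-dec _≟ᴮ_

  opaque
    configuration : Vertex n → Bool
    configuration x = does (inConfiguration? x)

    configuration⇒ : ∀ x → configuration x ≡ true → InConfiguration x
    configuration⇒ x h with find (invert (inConfiguration? x) h)
      where
      invert : ∀ {P : Set} (p : Dec P) → does p ≡ true → P
      invert (yes q) _ = q
    ... | w , w∈ , end with find end
    ...   | k , k∈ , seg = w , w∈ , k , ≤-pred (∈-upTo⁻ k∈) , seg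

    configuration⇐ : ∀ x → InConfiguration x → configuration x ≡ true
    configuration⇐ x (w , w∈ , k , k≤d , seg) = dec-true (inConfiguration? x) (lose w∈ (lose (∈-upTo⁺ (s≤s k≤d)) seg))

  origin-in : ∀ {w} → w ∈ A → configuration origin ≡ true
  origin-in w∈ = configuration⇐ origin (_ , w∈ , 0 , z≤n , inj₁ (sym (toggle-[] origin)))

  -- Cond1 on the initial segment of length d - 1 of w; Cond2 excludes x = reverse w.
  member-≡-of-SameElements : ∀ {w x} → w ∈ A → x ∈ A → SameElements w x → w ≡ x
  member-≡-of-SameElements {w} {x} w∈ x∈ same
    with cond1 w x w∈ x∈ (suc e) (s≤s z≤n) ≤-refl w (inj₁ refl) (All.tabulate (λ {a} p → proj₁ (same a) (∈-take⁻ (suc e) w p)))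
  ... | inj₁ eq = ≡-from-init-and-elements (suc e) w x (sym eq) (length-member w∈) (length-member x∈)
                    same (unique-member w∈) (unique-member x∈)
  ... | inj₂ eq = ⊥-elim (cond2 w w∈ (subst (_∈ A) (sym reverse-w≡x) x∈))
    where
    w≡reverse-x : w ≡ reverse x
    w≡reverse-x = ≡-from-init-and-elements (suc e) w (reverse x) (sym eq) (length-member w∈)
      (trans (length-reverse x) (length-member x∈))
      (λ a → (λ p → ∈-reverse⁺ (proj₁ (same a) p)) , (λ p → proj₂ (same a) (∈-reverse⁻ p)))
      (unique-member w∈) (unique-reverse (unique-member x∈))
    reverse-w≡x : reverse w ≡ x
    reverse-w≡x = trans (cong reverse w≡reverse-x) (reverse-involutive x)

  spannedCube-injective : ∀ {w x} → w ∈ A → x ∈ A → spannedCube origin w ≡ spannedCube origin x → w ≡ x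
  spannedCube-injective {w} {x} w∈ x∈ eq = member-≡-of-SameElements w∈ x∈ λ a →
    (λ p → Free-spannedCube⁻ origin x a (subst (λ R → Free R a) eq (Free-spannedCube⁺ origin w a p))) ,
    (λ p → Free-spannedCube⁻ origin w a (subst (λ R → Free R a) (sym eq) (Free-spannedCube⁺ origin x a p)))

  module _ {w} (w∈ : w ∈ A) where

    private
      R : SubCube n
      R = spannedCube origin w

      open StandardCycle {n} {suc e} origin w (unique-member w∈) (length-member w∈)

      -- By Cond1, an end-segment of another member lying inside w is itself an end-segment of w.
      end-segment-is-corner : ∀ {x} → x ∈ A → ∀ k → k ≤ d → ∀ s → (s ≡ x ⊎ s ≡ reverse x) →
        (∀ a → a ∈ take k s → a ∈ w) → ∃ λ t → t < d + d × corner t ≡ toggle (take k s) origin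
      end-segment-is-corner {x} x∈ k k≤d s s-or sub with k ≟ 0 | k ≟ d
      ... | yes refl | _ = 0 , s≤s z≤n , corner-take 0 z≤n
      ... | no _ | yes refl = d , m<m+n d (s≤s z≤n) , (begin
        corner d                     ≡⟨ corner-take d ≤-refl ⟩
        toggle (take d w) origin     ≡⟨ cong (λ E → toggle E origin) (take-all d w (≤-reflexive (length-member w∈))) ⟩
        toggle w origin              ≡⟨ toggle-cong origin w~s ⟩
        toggle s origin              ≡⟨ cong (λ E → toggle E origin) (sym take-s) ⟩
        toggle (take d s) origin     ∎)
        where
        open ≡-Reasoning
        length-s : length s ≡ d
        length-s = trans (length-of-≡-or-reverse s-or) (length-member x∈)
        unique-s : Unique s
        unique-s = unique-of-≡-or-reverse s-or (unique-member x∈)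
        take-s : take d s ≡ s
        take-s = take-all d s (≤-reflexive length-s)
        s⊆w : ∀ a → a ∈ s → a ∈ w
        s⊆w a p = sub a (subst (a ∈_) (sym take-s) p)
        w~s : SameElements w s
        w~s a = unique⊆∧length≥⇒⊇ unique-s s⊆w (≤-reflexive (trans (length-member w∈) (sym length-s))) a , s⊆w a
      ... | no k≢0 | no k≢d with cond1 x w x∈ w∈ k (n≢0⇒n>0 k≢0) (≤∧≢⇒< k≤d k≢d) s s-or (All.tabulate (λ {a} → sub a))
      ...   | inj₁ eq = k , ≤-trans (≤∧≢⇒< k≤d k≢d) (m≤m+n d d) , trans (corner-take k k≤d) (cong (λ E → toggle E origin) eq)
      ...   | inj₂ eq with corner-take-reverse k k≤d
      ...     | t , t<2d , corner-t = t , t<2d , trans corner-t (cong (λ E → toggle E origin) eq)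

      traceCycle : TraceCycle d R configuration
      traceCycle = record
        { cycle = cubeCycle R (InCube-spannedCube origin w) (Free-spannedCube⁺ origin w)
        ; covers = covers
        ; inS = λ i → let (k , k≤d , seg) = corner-end-segment (toℕ i) in configuration⇐ _ (w , w∈ , k , k≤d , seg)
        }
        where
        covers : ∀ x → InCube R x → configuration x ≡ true → ∃ λ (i : Fin (d + d)) → corner (toℕ i) ≡ x
        covers x x∈R Sx with configuration⇒ x Sx
        ... | x′ , x′∈ , k , k≤d , seg = fromℕ< t<2d , trans (cong corner (toℕ-fromℕ< t<2d)) (trans corner-t (sym x≡))
          where
          oriented : ∃ λ s → (s ≡ x′ ⊎ s ≡ reverse x′) × x ≡ toggle (take k s) origin
          oriented = [ (λ e → x′ , inj₁ refl , e) , (λ e → reverse x′ , inj₂ refl , e) ]′ seg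
          s = proj₁ oriented
          x≡ = proj₂ (proj₂ oriented)
          inside : ∀ a → a ∈ take k s → a ∈ w
          inside a p = Free-spannedCube⁻ origin w a
            (toggle-InCube⇒Free R origin (take k s) (InCube-spannedCube origin w) (subst (InCube R) x≡ x∈R) a p)
          hit = end-segment-is-corner x′∈ k k≤d s (proj₁ (proj₂ oriented)) inside
          t = proj₁ hit
          t<2d = proj₁ (proj₂ hit)
          corner-t = proj₂ (proj₂ hit)

    spannedCube-good : GoodCube d n configuration origin (spannedCube origin w)
    spannedCube-good = trans (freeCount-spannedCube origin w (unique-member w∈)) (length-member w∈) ,
      InCube-spannedCube origin w ,
      TraceCycle⇒IsCopyC2d d R configuration (trans (freeCount-spannedCube origin w (unique-member w∈)) (length-member w∈))
        traceCycle corner-injective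

  goodCube⇒spanned : ∀ R → GoodCube d n configuration origin R → ∃ λ w → w ∈ A × R ≡ spannedCube origin w
  goodCube⇒spanned R (fc , origin∈R , copy) = w , w∈ , ≡-spannedCube origin w R origin∈R free~w
    where
    open TraceCycle (IsCopyC2d⇒TraceCycle d R configuration fc copy)
    i₀ : Fin (d + d)
    i₀ = proj₁ (covers origin origin∈R (origin-in (proj₁ (proj₂ (configuration⇒ _ (inS zero))))))
    open CubeCycleStructure {n} {suc e} fc cycle i₀
    full = vertex-prefix d ≤-refl
    full-in = configuration⇒ _ (inS (proj₁ full))
    w = proj₁ full-in
    w∈ = proj₁ (proj₂ full-in)
    order≡ : toggle order origin ≡ vertex (proj₁ full)
    order≡ = sym (trans (proj₂ full) (cong₂ toggle (take-all d order (≤-reflexive length-order))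
               (proj₂ (covers origin origin∈R _))))
    order⊆w : ∀ a → a ∈ order → a ∈ w
    order⊆w a p with proj₂ (proj₂ (proj₂ (proj₂ full-in)))
    ... | inj₁ e = ∈-take⁻ _ w (proj₁ (toggle-injective origin (trans order≡ e) a) p)
    ... | inj₂ e = ∈-reverse⁻ (∈-take⁻ _ (reverse w) (proj₁ (toggle-injective origin (trans order≡ e) a) p))
    free~w : SameElements (freeCoords R) w
    free~w a = (λ p → order⊆w a (proj₂ (order-spans a) p)) ,
      (λ p → proj₁ (order-spans a) (unique⊆∧length≥⇒⊇ unique-order order⊆w
        (≤-reflexive (trans (length-member w∈) (sym length-order))) a p))

  configuration-count : Gin d n configuration origin (length A)
  configuration-count = map (spannedCube origin) A ,
    unique-map (spannedCube origin) A (proj₁ (proj₁ pu)) spannedCube-injective ,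
    length-map (spannedCube origin) A , λ R → to R , from R
    where
    to : ∀ R → R ∈ map (spannedCube origin) A → GoodCube d n configuration origin R
    to R p with ∈-map⁻ (spannedCube origin) p
    ... | w , w∈ , refl = spannedCube-good w∈
    from : ∀ R → GoodCube d n configuration origin R → R ∈ map (spannedCube origin) A
    from R good with goodCube⇒spanned R good
    ... | w , w∈ , refl = ∈-map⁺ (spannedCube origin) w∈

headIndex : ∀ {n} → List (Fin n) → ℕ
headIndex [] = 0
headIndex (a ∷ _) = toℕ a

-- Of a sequence and its reversal exactly one is oriented (for length at least 2).
Oriented : ∀ {n} → List (Fin n) → Set
Oriented w = headIndex w < headIndex (reverse w)

module GoodCubeSequences {n e : ℕ} (S : Vertex n → Bool) (v : Vertex n) (Sv : S v ≡ true) where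

  open UniqueCounting (_≟ᶠ_ {n})

  private
    d : ℕ
    d = suc (suc e)

  Good : SubCube n → Set
  Good = GoodCube d n S v

  -- The order in which the perfect cycle in R flips the free coordinates, read from v.
  record FlipSequence (R : SubCube n) : Set where
    field
      sequence : Seq n
      unique : Unique sequence
      length≡ : length sequence ≡ d
      v∈R : InCube R v
      spans : SameElements sequence (freeCoords R)
      end-segments-in : ∀ m → m ≤ d → S (toggle (take m sequence) v) ≡ true × S (toggle (take m (reverse sequence)) v) ≡ true
      only-end-segments : ∀ x → InCube R x → S x ≡ true → ∃ λ m → m ≤ d × EndSegmentVertex v sequence m x

  reverse-FlipSequence : ∀ {R} → FlipSequence R → FlipSequence R
  reverse-FlipSequence {R} F = record
    { sequence = reverse sequence
    ; unique = unique-reverse unique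
    ; length≡ = trans (length-reverse sequence) length≡
    ; v∈R = v∈R
    ; spans = λ a → (λ p → proj₁ (spans a) (∈-reverse⁻ p)) , (λ p → ∈-reverse⁺ (proj₂ (spans a) p))
    ; end-segments-in = λ m m≤d → proj₂ (end-segments-in m m≤d) ,
        subst (λ z → S (toggle (take m z) v) ≡ true) (sym (reverse-involutive sequence)) (proj₁ (end-segments-in m m≤d))
    ; only-end-segments = λ x x∈R Sx → let (m , m≤d , seg) = only-end-segments x x∈R Sx in
        m , m≤d , EndSegmentVertex-reverse v sequence seg
    }
    where open FlipSequence F

  Good⇒FlipSequence : ∀ R → Good R → FlipSequence R
  Good⇒FlipSequence R (fc , v∈R , copy) = record
    { sequence = order
    ; unique = unique-order
    ; length≡ = length-order
    ; v∈R = v∈R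
    ; spans = order-spans
    ; end-segments-in = λ m m≤d → in-S (vertex-prefix m m≤d) , in-S (vertex-suffix m m≤d)
    ; only-end-segments = only-end-segments
    }
    where
    open TraceCycle (IsCopyC2d⇒TraceCycle d R S fc copy)
    i₀ : Fin (d + d)
    i₀ = proj₁ (covers v v∈R Sv)
    v≡ : vertex i₀ ≡ v
    v≡ = proj₂ (covers v v∈R Sv)
    open CubeCycleStructure {n} {suc e} fc cycle i₀
    in-S : ∀ {E} → (∃ λ i → vertex i ≡ toggle E (vertex i₀)) → S (toggle E v) ≡ true
    in-S {E} (i , eq) = trans (cong S (sym (trans eq (cong (toggle E) v≡)))) (inS i)
    only-end-segments : ∀ x → InCube R x → S x ≡ true → ∃ λ m → m ≤ d × EndSegmentVertex v order m x
    only-end-segments x x∈R Sx with covers x x∈R Sx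
    ... | i , vertex-i with vertex-end-segment i
    ...   | m , m≤d , seg = m , m≤d , [ (λ e → inj₁ (rebase e)) , (λ e → inj₂ (rebase e)) ]′ seg
      where
      rebase : ∀ {E} → vertex i ≡ toggle E (vertex i₀) → x ≡ toggle E v
      rebase {E} e = trans (sym vertex-i) (trans e (cong (toggle E) v≡))

  oriented-FlipSequence : ∀ {R} → FlipSequence R → Σ (FlipSequence R) (Oriented ∘ FlipSequence.sequence)
  oriented-FlipSequence F with headIndex (sequence F) <? headIndex (reverse (sequence F))
    where open FlipSequence
  ... | yes lt = F , lt
  ... | no ≮ = reverse-FlipSequence F ,
    subst (λ z → headIndex (reverse (FlipSequence.sequence F)) < headIndex z) (sym (reverse-involutive (FlipSequence.sequence F)))
      (≤∧≢⇒< (≮⇒≥ ≮) (λ e → ends-differ (sym e)))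
    where
    open FlipSequence F
    ends-differ : headIndex sequence ≢ headIndex (reverse sequence)
    ends-differ eq with sequence | unique | length≡
    ... | a ∷ rest | u | len with head≢last a rest e u (suc-injective len)
    ...   | l , r , rev≡ , a≢l = a≢l (toℕ-injective (trans eq (cong headIndex rev≡)))

  orientedSequence : ∀ R → Good R → Seq n
  orientedSequence R g = FlipSequence.sequence (proj₁ (oriented-FlipSequence (Good⇒FlipSequence R g)))

  sequencesOf : (L : List (SubCube n)) → (∀ R → R ∈ L → Good R) → List (Seq n)
  sequencesOf [] good = []
  sequencesOf (R ∷ L) good = orientedSequence R (good R (here refl)) ∷ sequencesOf L (λ R′ p → good R′ (there p))

  length-sequencesOf : ∀ L good → length (sequencesOf L good) ≡ length L
  length-sequencesOf [] good = refl
  length-sequencesOf (R ∷ L) good = cong suc (length-sequencesOf L _)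

  ∈-sequencesOf⁻ : ∀ L good {w} → w ∈ sequencesOf L good →
    ∃ λ R → R ∈ L × Σ (FlipSequence R) λ F → Oriented (FlipSequence.sequence F) × w ≡ FlipSequence.sequence F
  ∈-sequencesOf⁻ (R ∷ L) good (here eq) = let (F , o) = oriented-FlipSequence (Good⇒FlipSequence R (good R (here refl))) in
    R , here refl , F , o , eq
  ∈-sequencesOf⁻ (R ∷ L) good (there p) with ∈-sequencesOf⁻ L (λ R′ q → good R′ (there q)) p
  ... | R′ , R′∈ , F , o , eq = R′ , there R′∈ , F , o , eq

  -- A subcube through v is determined by its free coordinates.
  FlipSequence-injective : ∀ {R R′} (F : FlipSequence R) (F′ : FlipSequence R′) →
    FlipSequence.sequence F ≡ FlipSequence.sequence F′ → R ≡ R′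
  FlipSequence-injective {R} {R′} F F′ eq = subCube-≡ R R′ v (FlipSequence.v∈R F) (FlipSequence.v∈R F′)
    (λ a h → ∈-freeCoords⁻ R′ a (proj₁ (FlipSequence.spans F′ a) (subst (a ∈_) eq (proj₂ (FlipSequence.spans F a) (∈-freeCoords⁺ R a h)))))
    (λ a h → ∈-freeCoords⁻ R a (proj₁ (FlipSequence.spans F a) (subst (a ∈_) (sym eq) (proj₂ (FlipSequence.spans F′ a) (∈-freeCoords⁺ R′ a h)))))

  unique-sequencesOf : ∀ L good → Unique L → Unique (sequencesOf L good)
  unique-sequencesOf [] good u = []
  unique-sequencesOf (R ∷ L) good u = unique-∷ w∉ (unique-sequencesOf L _ (unique-tail u))
    where
    F = oriented-FlipSequence (Good⇒FlipSequence R (good R (here refl)))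
    w∉ : orientedSequence R (good R (here refl)) ∉ sequencesOf L (λ R′ p → good R′ (there p))
    w∉ p with ∈-sequencesOf⁻ L (λ R′ q → good R′ (there q)) p
    ... | R′ , R′∈ , F′ , _ , eq = head∉tail u (subst (_∈ L) (sym (FlipSequence-injective (proj₁ F) F′ eq)) R′∈)

  -- Every end-segment of F lying in the cube of F′ is an S-vertex of that cube, hence an
  -- end-segment of F′ of the same length.
  end-segments-match : ∀ {R R′} (F : FlipSequence R) (F′ : FlipSequence R′) → ∀ j s →
    (s ≡ FlipSequence.sequence F ⊎ s ≡ reverse (FlipSequence.sequence F)) → j ≤ d →
    All (_∈ FlipSequence.sequence F′) (take j s) → ∀ i → i ≤ j →
    SameElements (take i s) (take i (FlipSequence.sequence F′)) ⊎ SameElements (take i s) (take i (reverse (FlipSequence.sequence F′)))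
  end-segments-match {R} {R′} F F′ j s s-or j≤d inside i i≤j
    with F′.only-end-segments P P∈R′ (S-end-segment s-or)
    where
    module F = FlipSequence F
    module F′ = FlipSequence F′
    P = toggle (take i s) v
    P∈R′ : InCube R′ P
    P∈R′ = InCube-toggle R′ v (take i s) F′.v∈R λ a p →
      ∈-freeCoords⁻ R′ a (proj₁ (F′.spans a) (All.lookup inside (∈-take-mono s i≤j p)))
    S-end-segment : ∀ {s′} → (s′ ≡ F.sequence ⊎ s′ ≡ reverse F.sequence) → S (toggle (take i s′) v) ≡ true
    S-end-segment (inj₁ refl) = proj₁ (F.end-segments-in i (≤-trans i≤j j≤d))
    S-end-segment (inj₂ refl) = proj₂ (F.end-segments-in i (≤-trans i≤j j≤d))
  ... | m , m≤d , seg = [ (λ e → inj₁ (same-length-prefix F′.sequence F′.length≡ (F′.unique) e)) ,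
                          (λ e → inj₂ (same-length-prefix (reverse F′.sequence) (trans (length-reverse F′.sequence) F′.length≡)
                                    (unique-reverse F′.unique) e)) ]′ seg
    where
    module F = FlipSequence F
    module F′ = FlipSequence F′
    length-s : length s ≡ d
    length-s = trans (length-of-≡-or-reverse s-or) F.length≡
    unique-s : Unique s
    unique-s = unique-of-≡-or-reverse s-or F.unique
    same-length-prefix : ∀ x → length x ≡ d → Unique x → toggle (take i s) v ≡ toggle (take m x) v →
      SameElements (take i s) (take i x)
    same-length-prefix x lx ux e = subst (λ z → SameElements (take i s) (take z x)) m≡i same
      where
      same = toggle-injective v e
      m≡i : m ≡ i
      m≡i = trans (sym (length-take-≤ m x (subst (m ≤_) (sym lx) m≤d)))
        (trans (sym (length-≡-of-SameElements (Unique.take⁺ i unique-s) (Unique.take⁺ m ux) same))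
          (length-take-≤ i s (subst (i ≤_) (sym length-s) (≤-trans i≤j j≤d))))

  end-segment-orientation : ∀ {R R′} (F : FlipSequence R) (F′ : FlipSequence R′) → ∀ j s →
    (s ≡ FlipSequence.sequence F ⊎ s ≡ reverse (FlipSequence.sequence F)) → j < d →
    All (_∈ FlipSequence.sequence F′) (take j s) →
    take j (FlipSequence.sequence F′) ≡ take j s ⊎ take j (reverse (FlipSequence.sequence F′)) ≡ take j s
  end-segment-orientation F F′ j s s-or j<d inside with matches j ≤-refl
    where
    matches = end-segments-match F F′ j s s-or (<⇒≤ j<d) inside
  ... | inj₁ same = inj₁ (take-≡-of-prefixes-matching-ends (suc e) j s x unique-s F′.unique F′.length≡ (≤-pred j<d) matches same)
    where
    module F′ = FlipSequence F′
    x = F′.sequence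
    matches = end-segments-match F F′ j s s-or (<⇒≤ j<d) inside
    unique-s = unique-of-≡-or-reverse s-or (FlipSequence.unique F)
  ... | inj₂ same = inj₂ (take-≡-of-prefixes-matching-ends (suc e) j s (reverse x) unique-s
          (unique-reverse F′.unique) (trans (length-reverse x) F′.length≡) (≤-pred j<d) matches′ same)
    where
    module F′ = FlipSequence F′
    x = F′.sequence
    unique-s = unique-of-≡-or-reverse s-or (FlipSequence.unique F)
    matches′ : ∀ i → i ≤ j → SameElements (take i s) (take i (reverse x)) ⊎ SameElements (take i s) (take i (reverse (reverse x)))
    matches′ i i≤j = [ (λ m → inj₂ (subst (λ z → SameElements (take i s) (take i z)) (sym (reverse-involutive x)) m)) , inj₁ ]′
      (end-segments-match F F′ j s s-or (<⇒≤ j<d) inside i i≤j)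

  sequencesOf-PropertyU : ∀ L good → Unique L → PropertyU d n (sequencesOf L good)
  sequencesOf-PropertyU L good uL = (unique-sequencesOf L good uL , All.tabulate shape) , cond1 , cond2
    where
    A = sequencesOf L good
    shape : ∀ {w} → w ∈ A → length w ≡ d × Unique w
    shape p with ∈-sequencesOf⁻ L good p
    ... | _ , _ , F , _ , refl = FlipSequence.length≡ F , FlipSequence.unique F
    cond2 : Cond2 A
    cond2 w p q with ∈-sequencesOf⁻ L good p | ∈-sequencesOf⁻ L good q
    ... | _ , _ , F , o , refl | _ , _ , F′ , o′ , eq′ = <-asym o
      (subst (λ z → headIndex (reverse (FlipSequence.sequence F)) < headIndex z) (reverse-involutive (FlipSequence.sequence F))
        (subst Oriented (sym eq′) o′))
    cond1 : Cond1 d n A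
    cond1 w x p q j _ j<d s s-or inside with ∈-sequencesOf⁻ L good p | ∈-sequencesOf⁻ L good q
    ... | _ , _ , F , _ , refl | _ , _ , F′ , _ , refl = end-segment-orientation F F′ j s s-or j<d inside

  family-of-good-cubes : ∀ k → Gin d n S v k → ∃ λ A → PropertyU d n A × length A ≡ k
  family-of-good-cubes k (L , uL , length-L , members) =
    sequencesOf L good , sequencesOf-PropertyU L good uL , trans (length-sequencesOf L good) length-L
    where
    good : ∀ R → R ∈ L → Good R
    good R = proj₁ (members R)

-- T(d, n) exists: up to reordering, a family with Property U is a sublist of the finite list of
-- all duplicate-free sequences of length d, and Property U is decidable.
module MaximumFamily (n d : ℕ) where

  private
    _≟ˢ_ : DecidableEquality (Seq n)
    _≟ˢ_ = List.≡-dec _≟ᶠ_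

    _∈ˢ?_ : (w : Seq n) (A : List (Seq n)) → Dec (w ∈ A)
    w ∈ˢ? A = any? (w ≟ˢ_) A

  sequencesOfLength : ℕ → List (Seq n)
  sequencesOfLength zero = [] ∷ []
  sequencesOfLength (suc k) = concatMap (λ a → map (a ∷_) (sequencesOfLength k)) (allFin n)

  ∈-sequencesOfLength : ∀ k (w : Seq n) → length w ≡ k → w ∈ sequencesOfLength k
  ∈-sequencesOfLength zero [] _ = here refl
  ∈-sequencesOfLength (suc k) (a ∷ w) eq = ∈-concatMap⁺ (λ a → map (a ∷_) (sequencesOfLength k))
    (lose (∈-allFin a) (∈-map⁺ (a ∷_) (∈-sequencesOfLength k w (suc-injective eq))))

  candidates : List (Seq n)
  candidates = deduplicate _≟ˢ_ (sequencesOfLength d)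

  unique-candidates : Unique candidates
  unique-candidates = deduplicate-! _≟ˢ_ (sequencesOfLength d)

  ∈-candidates : ∀ w → length w ≡ d → w ∈ candidates
  ∈-candidates w eq = ∈-deduplicate⁺ _≟ˢ_ (∈-sequencesOfLength d w eq)

  sublists : ∀ {X : Set} → List X → List (List X)
  sublists [] = [] ∷ []
  sublists (x ∷ xs) = map (x ∷_) (sublists xs) ++ sublists xs

  filter∈sublists : ∀ {X : Set} {P : X → Set} (P? : ∀ x → Dec (P x)) (xs : List X) → filter P? xs ∈ sublists xs
  filter∈sublists P? [] = here refl
  filter∈sublists P? (x ∷ xs) with P? x
  ... | yes _ = ∈-++⁺ˡ (∈-map⁺ (x ∷_) (filter∈sublists P? xs))
  ... | no _ = ∈-++⁺ʳ (map (x ∷_) (sublists xs)) (filter∈sublists P? xs)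

  PropertyU-resp-SameElements : ∀ (A B : List (Seq n)) → Unique B → SameElements A B → PropertyU d n A → PropertyU d n B
  PropertyU-resp-SameElements A B uB same ((_ , shape) , cond1 , cond2) =
    (uB , All.tabulate (λ p → All.lookup shape (proj₂ (same _) p))) ,
    (λ w x p q → cond1 w x (proj₂ (same w) p) (proj₂ (same x) q)) ,
    (λ w p r → cond2 w (proj₂ (same w) p) (proj₂ (same (reverse w)) r))

  private
    EndSegmentCondition : Seq n → ℕ → Seq n → Set
    EndSegmentCondition x j s = All (_∈ x) (take j s) → (take j x ≡ take j s ⊎ take j (reverse x) ≡ take j s)

    Cond1-at : Seq n → Seq n → ℕ → Set
    Cond1-at w x j = 1 ≤ j → EndSegmentCondition x j w × EndSegmentCondition x j (reverse w)

    Cond1-at? : ∀ w x j → Dec (Cond1-at w x j)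
    Cond1-at? w x j = (1 ≤? j) →-dec (condition? w ×-dec condition? (reverse w))
      where
      condition? : ∀ s → Dec (EndSegmentCondition x j s)
      condition? s = all? (λ a → a ∈ᶠ? x) (take j s) →-dec ((take j x ≟ˢ take j s) ⊎-dec (take j (reverse x) ≟ˢ take j s))

    Cond1′ : List (Seq n) → Set
    Cond1′ A = All (λ w → All (λ x → All (Cond1-at w x) (upTo d)) A) A

    Cond1′⇔Cond1 : ∀ A → Cond1′ A ⇔ Cond1 d n A
    Cond1′⇔Cond1 A = mk⇔ to from
      where
      to : Cond1′ A → Cond1 d n A
      to h w x p q j 1≤j j<d s (inj₁ refl) = proj₁ (All.lookup (All.lookup (All.lookup h p) q) (∈-upTo⁺ j<d) 1≤j)
      to h w x p q j 1≤j j<d s (inj₂ refl) = proj₂ (All.lookup (All.lookup (All.lookup h p) q) (∈-upTo⁺ j<d) 1≤j)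
      from : Cond1 d n A → Cond1′ A
      from c = All.tabulate λ {w} p → All.tabulate λ {x} q → All.tabulate λ {j} r 1≤j →
        c w x p q j 1≤j (∈-upTo⁻ r) w (inj₁ refl) , c w x p q j 1≤j (∈-upTo⁻ r) (reverse w) (inj₂ refl)

  PropertyU? : ∀ A → Dec (PropertyU d n A)
  PropertyU? A =
    (unique? _≟ˢ_ A ×-dec all? (λ w → (length w ≟ d) ×-dec unique? _≟ᶠ_ w) A) ×-dec
    (Dec.map (Cond1′⇔Cond1 A) (all? (λ w → all? (λ x → all? (Cond1-at? w x) (upTo d)) A) A) ×-dec
     Dec.map (mk⇔ (λ h w p → All.lookup h p) (λ c → All.tabulate (λ {w} → c w))) (all? (λ w → ¬? (reverse w ∈ˢ? A)) A))

  largest : (C : List (List (Seq n))) →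
    ∃ λ B → PropertyU d n B × (∀ B′ → B′ ∈ C → PropertyU d n B′ → length B′ ≤ length B)
  largest [] = [] , (([] , []) , (λ _ _ ()) , (λ _ ())) , λ _ ()
  largest (B ∷ C) with largest C | PropertyU? B
  ... | B₀ , u₀ , max₀ | no ¬u = B₀ , u₀ , λ { B′ (here refl) u → ⊥-elim (¬u u) ; B′ (there p) u → max₀ B′ p u }
  ... | B₀ , u₀ , max₀ | yes u with length B ≤? length B₀
  ...   | yes ≤₀ = B₀ , u₀ , λ { B′ (here refl) _ → ≤₀ ; B′ (there p) u′ → max₀ B′ p u′ }
  ...   | no ≰₀ = B , u , λ { B′ (here refl) _ → ≤-refl ; B′ (there p) u′ → ≤-trans (max₀ B′ p u′) (<⇒≤ (≰⇒> ≰₀)) }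

  maximum : List (Seq n)
  maximum = proj₁ (largest (sublists candidates))

  maximum-PropertyU : PropertyU d n maximum
  maximum-PropertyU = proj₁ (proj₂ (largest (sublists candidates)))

  maximum-maximal : ∀ A → PropertyU d n A → length A ≤ length maximum
  maximum-maximal A uA = subst (_≤ length maximum) (sym length-A≡)
    (proj₂ (proj₂ (largest (sublists candidates))) B (filter∈sublists (_∈ˢ? A) candidates) (PropertyU-resp-SameElements A B unique-B same uA))
    where
    B = filter (_∈ˢ? A) candidates
    unique-B : Unique B
    unique-B = Unique.filter⁺ (_∈ˢ? A) unique-candidates
    same : SameElements A B
    same w = (λ p → ∈-filter⁺ (_∈ˢ? A) (∈-candidates w (proj₁ (All.lookup (proj₂ (proj₁ uA)) p))) p) ,
             (λ p → proj₂ (∈-filter⁻ (_∈ˢ? A) {xs = candidates} p))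
    length-A≡ : length A ≡ length B
    length-A≡ = UniqueCounting.length-≡-of-SameElements _≟ˢ_ (proj₁ (proj₁ uA)) unique-B same

  IsTmax-maximum : IsTmax d n (length maximum)
  IsTmax-maximum = (maximum , maximum-PropertyU , refl) , maximum-maximal

singleton-PropertyU : ∀ {n e} (w : Seq n) → Unique w → length w ≡ suc (suc e) → PropertyU (suc (suc e)) n (w ∷ [])
singleton-PropertyU {e = e} w u len = ([] ∷ [] , (len , u) ∷ []) , cond1 , cond2
  where
  cond1 : Cond1 _ _ (w ∷ [])
  cond1 _ _ (here refl) (here refl) j _ _ s (inj₁ refl) _ = inj₁ refl
  cond1 _ _ (here refl) (here refl) j _ _ s (inj₂ refl) _ = inj₂ refl
  cond2 : Cond2 (w ∷ [])
  cond2 _ (here refl) (here rev≡) = reverse≢self w e u len rev≡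

proposition7 : (d n : ℕ) → 2 ≤ d → d ≤ n →
    Σ ℕ (λ m → IsGmax d n m × IsTmax d n m)
proposition7 d@(suc (suc e)) n (s≤s (s≤s z≤n)) d≤n = length maximum , isGmax , IsTmax-maximum
  where
  open MaximumFamily n d
  first-d : Seq n
  first-d = take d (allFin n)
  some-member : ∃ (_∈ maximum)
  some-member with maximum | maximum-maximal (first-d ∷ [])
    (singleton-PropertyU first-d (Unique.take⁺ d (Unique.allFin⁺ n)) (length-take-≤ d (allFin n) (subst (d ≤_) (sym (length-tabulate id)) d≤n)))
  ... | [] | ()
  ... | w ∷ _ | _ = w , here refl
  open FamilyConfiguration maximum maximum-PropertyU
  isGmax : IsGmax d n (length maximum)
  isGmax = (configuration , origin , origin-in (proj₂ some-member) , configuration-count) ,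
    λ S v k Sv Gin-k → let (A , uA , length-A) = GoodCubeSequences.family-of-good-cubes {e = e} S v Sv k Gin-k in
      subst (_≤ length maximum) length-A (maximum-maximal A uA)
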